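{- Let $n\ge 2$ and $0\le i\le n-1$, and let $c_{n,i}$ be the number of conjugacy classes of simple $n$-braids of length $i$ (i.e. the number of equivalence classes of the set of simple $n$-braids of length $i$ under conjugacy in the braid group $B_n$). Then $$c_{n,i}=P\big(i+\min(i,n-i),\,\min(i,n-i)\big).$$
   Context: The braid group $B_n$ has generators $x_1,\dots,x_{n-1}$ and relations $x_ix_j=x_jx_i$ for $|i-j|\ge 2$ and $x_ix_{i+1}x_i=x_{i+1}x_ix_{i+1}$ for $1\le i\le n-2$; positive braids are elements represented by positive words, and their length (number of letters) is well defined. A simple braid is a positive braid that can be represented by a positive word in which each letter $x_i$ occurs at most once. $P(m,k)$ denotes the number of partitions of the positive integer $m$ into exactly $k$ positive parts, i.e. representations $m=m_1+\cdots+m_k$ with $m_1\ge\cdots\ge m_k\ge 1$; by convention $P(0,0)=1$. -}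

module Defs where

open import Data.Nat using (ℕ; zero; suc; _+_; _≤_; _≤ᵇ_; _≡ᵇ_)
open import Data.Bool using (Bool; true; false; _∧_)
open import Data.Fin using (Fin; toℕ)
open import Data.List using (List; []; _∷_; _++_; map; reverse; length; filterᵇ; concatMap; upTo)
open import Data.Vec as Vec using (Vec)
open import Data.Product using (Σ; ∃; _×_)
open import Data.List.Relation.Unary.All using (All)
open import Data.List.Relation.Unary.Any using (Any)
open import Data.List.Relation.Unary.AllPairs using (AllPairs)
open import Data.List.Relation.Unary.Unique.Propositional using (Unique)
open import Relation.Binary.PropositionalEquality using (_≡_)
open import Relation.Nullary using (¬_)

-- Braid group B_n, presented by generators and relations.
-- For B_n we use m = n ∸ 1 generators; the generator indexed by
-- j : Fin m is x_{j+1}.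

data Letter (m : ℕ) : Set where
  gen : Fin m → Letter m
  inv : Fin m → Letter m

Word : ℕ → Set
Word m = List (Letter m)

data Rel₀ {m : ℕ} : Word m → Word m → Set where
  cancel-l : (a : Fin m) → Rel₀ (gen a ∷ inv a ∷ []) []
  cancel-r : (a : Fin m) → Rel₀ (inv a ∷ gen a ∷ []) []
  commute  : (a b : Fin m) → 2 + toℕ a ≤ toℕ b →
             Rel₀ (gen a ∷ gen b ∷ []) (gen b ∷ gen a ∷ [])
  braid    : (a b : Fin m) → toℕ b ≡ suc (toℕ a) →
             Rel₀ (gen a ∷ gen b ∷ gen a ∷ []) (gen b ∷ gen a ∷ gen b ∷ [])

data _≈_ {m : ℕ} : Word m → Word m → Set where
  step  : ∀ {u v} (p s : Word m) → Rel₀ u v → (p ++ u ++ s) ≈ (p ++ v ++ s)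
  ≈refl  : ∀ {u} → u ≈ u
  ≈sym   : ∀ {u v} → u ≈ v → v ≈ u
  ≈trans : ∀ {u v w} → u ≈ v → v ≈ w → u ≈ w

invLetter : ∀ {m} → Letter m → Letter m
invLetter (gen a) = inv a
invLetter (inv a) = gen a

invWord : ∀ {m} → Word m → Word m
invWord w = reverse (map invLetter w)

Conjugate : ∀ {m} → Word m → Word m → Set
Conjugate {m} u v = ∃ λ (g : Word m) → (g ++ u ++ invWord g) ≈ v

pos : ∀ {m} → List (Fin m) → Word m
pos = map gen

-- A positive word of length i in which each letter occurs at most once;
-- the simple braids of length i are exactly the braids represented by these.
SimpleWord : ∀ {m} → ℕ → List (Fin m) → Set
SimpleWord i w = Unique w × length w ≡ i

-- "The number of conjugacy classes of simple n-braids of length i is c":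
-- there are c representatives, simple of length i, pairwise non-conjugate
-- in B_n, such that every simple braid of length i is conjugate to one.
ConjClassCount : (n i c : ℕ) → Set
ConjClassCount n i c =
  Σ (List (List (Fin (n Data.Nat.∸ 1)))) λ reps →
    length reps ≡ c
    × All (SimpleWord i) reps
    × AllPairs (λ u v → ¬ Conjugate (pos u) (pos v)) reps
    × (∀ w → SimpleWord i w → Any (λ r → Conjugate (pos w) (pos r)) reps)

-- Partitions: P m k = number of (m₁,…,mₖ) with m₁ ≥ ⋯ ≥ mₖ ≥ 1 and
-- m₁ + ⋯ + mₖ = m, counted by enumerating all vectors with entries ≤ m.

allVecs : (m k : ℕ) → List (Vec ℕ k)
allVecs m zero    = Vec.[] ∷ []
allVecs m (suc k) = concatMap (λ x → map (x Vec.∷_) (allVecs m k)) (upTo (suc m))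

nonincPosᵇ : ∀ {k} → Vec ℕ k → Bool
nonincPosᵇ Vec.[] = true
nonincPosᵇ (x Vec.∷ Vec.[]) = 1 ≤ᵇ x
nonincPosᵇ (x Vec.∷ (y Vec.∷ v)) = (y ≤ᵇ x) ∧ nonincPosᵇ (y Vec.∷ v)

isPartitionᵇ : (m : ℕ) → ∀ {k} → Vec ℕ k → Bool
isPartitionᵇ m v = (Vec.sum v ≡ᵇ m) ∧ nonincPosᵇ v

P : ℕ → ℕ → ℕ
P m k = length (filterᵇ (isPartitionᵇ m) (allVecs m k))

module Submission where

-- A simple n-braid of length i is a product of i distinct generators.  Up to
-- conjugacy the order of the letters does not matter, so such a braid is
-- conjugate to an increasing word x_s x_{s+1} ⋯ x_{s+c-1} x_{s+c+1} ⋯, i.e.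
-- a juxtaposition of "runs" of consecutive generators separated by gaps.
-- The run lengths c₁, c₂, … form a composition with Σ cⱼ = i and
-- Σ (cⱼ + 1) ≤ n.  Conjugating by Garside elements Δ of sub-braid groups
-- shows that two adjacent runs can be swapped, so every permutation of the
-- run lengths gives a conjugate braid; hence each simple braid is conjugate
-- to the canonical word of a partition of i into at most min(i, n-i) parts,
-- i.e. (adding one to each part) of a partition of i + min(i, n-i) into
-- exactly min(i, n-i) parts.  Conversely the canonical words of distinct
-- partitions are not conjugate: the image permutation in S_n is an
-- invariant, a run of length c becomes a (c+1)-cycle, and the number of
-- points of exact period c+1 recovers the multiplicities of the parts.

open import Defs
open import Data.Nat using (ℕ; zero; suc; _+_; _*_; _∸_; _≤_; _<_; z≤n; s≤s; _<?_; _≤?_; _≟_; pred; _≤ᵇ_; _≡ᵇ_; _⊓_)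
open import Data.Nat.Properties
open import Data.Fin using (Fin; toℕ; fromℕ<) renaming (zero to fzero)
open import Data.Fin.Properties using (toℕ-fromℕ<; toℕ-injective; toℕ<n)
open import Data.List using (List; []; _∷_; _++_; map; [_]; length; replicate; initLast; _∷ʳ′_; filterᵇ; upTo; concatMap)
open import Data.Nat.ListAction using (sum)
open import Data.Nat.ListAction.Properties using (sum-↭; sum-++)
import Data.List.Sort as Sort
open import Relation.Binary.Properties.DecTotalOrder ≤-decTotalOrder using (≥-decTotalOrder; ≥-totalOrder)
open import Data.List.Relation.Unary.Sorted.TotalOrder.Properties using (Sorted⇒AllPairs)
import Data.List.Relation.Binary.Permutation.Setoid.Properties as PermS
open import Data.List.Properties using (++-assoc; map-++; ++-identityʳ; unfold-reverse; length-++; length-map; map-∘; map-cong; map-id)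
open import Data.List.Relation.Unary.All as All using (All; []; _∷_; zipWith) renaming (map to Amap)
open import Data.List.Relation.Unary.Any as Any using (Any; here; there)
import Data.List.Relation.Unary.Any.Properties as AnyP
open import Data.List.Membership.Propositional using (_∈_)
open import Data.List.Membership.Propositional.Properties using (∈-∃++; ∈-++⁺ʳ; ∈-concatMap⁺; ∈-map⁺; ∈-upTo⁺; ∈-filter⁺)
import Data.List.Relation.Unary.All.Properties as AllP
open import Data.List.Relation.Unary.AllPairs as AllPairs using (AllPairs; []; _∷_)
import Data.List.Relation.Unary.AllPairs.Properties as APP
open import Data.List.Relation.Binary.Permutation.Propositional as Perm using (_↭_; ↭-refl; ↭-prep; ↭-trans; ↭-sym; ↭-reflexive; ↭⇒↭ₛ)
import Data.List.Relation.Binary.Permutation.Propositional.Properties as PermP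
open import Data.Product using (Σ; _×_; _,_; proj₁; proj₂)
open import Data.Sum using (_⊎_; inj₁; inj₂)
open import Data.Empty using (⊥-elim)
open import Relation.Binary.PropositionalEquality using (_≡_; _≢_; refl; sym; trans; cong; cong₂; subst; subst₂; ≢-sym; module ≡-Reasoning) renaming (setoid to ≡-setoid)
open import Relation.Nullary using (yes; no; ¬_)
open import Data.Vec using (Vec; []; _∷_; toList)
open import Data.Vec.Properties using (toList-injective; cast-is-id; length-toList)
import Data.Vec as Vec
open import Data.Bool using (Bool; true; false; T; _∧_; not)
open import Data.Bool.Properties using (T-∧; T?; ∧-zeroʳ)
open import Data.Unit using (tt)
open import Function using (id; _∘_; Equivalence; mk⇔)
open import Relation.Nullary.Decidable using (does; does-⇔; dec-true; dec-false)
open import Relation.Binary.Definitions using (tri<; tri≈; tri>)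
open import Data.Fin.Permutation using (Permutation; permutation; _⟨$⟩ʳ_)
import Algebra.Properties.CommutativeMonoid.Sum as SumP
open import Data.Nat.Tactic.RingSolver using (solve-∀)

≈-cong : ∀ {m} {u v : Word m} (p s : Word m) → u ≈ v → (p ++ u ++ s) ≈ (p ++ v ++ s)
≈-cong p s (step {u} {v} p' s' r) = subst₂ _≈_ (regroup u) (regroup v) (step (p ++ p') (s' ++ s) r)
  where
  regroup : ∀ x → (p ++ p') ++ x ++ s' ++ s ≡ p ++ (p' ++ x ++ s') ++ s
  regroup x = trans (++-assoc p p' _)
    (cong (p ++_) (sym (trans (++-assoc p' (x ++ s') s) (cong (p' ++_) (++-assoc x s' s)))))
≈-cong p s ≈refl = ≈refl
≈-cong p s (≈sym q) = ≈sym (≈-cong p s q)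
≈-cong p s (≈trans q r) = ≈trans (≈-cong p s q) (≈-cong p s r)

≈-reflexive : ∀ {m} {u v : Word m} → u ≡ v → u ≈ v
≈-reflexive refl = ≈refl

module ≈-Reasoning {m : ℕ} where
  infixr 2 _≈⟨_⟩_
  infix 3 _∎
  _≈⟨_⟩_ : ∀ (x : Word m) {y z} → x ≈ y → y ≈ z → x ≈ z
  x ≈⟨ p ⟩ q = ≈trans p q
  _∎ : ∀ (x : Word m) → x ≈ x
  x ∎ = ≈refl
  begin_ : ∀ {x y : Word m} → x ≈ y → x ≈ y
  begin p = p
  infix 1 begin_

invWord-∷ : ∀ {m} (l : Letter m) (w : Word m) → invWord (l ∷ w) ≡ invWord w ++ [ invLetter l ]
invWord-∷ l w = unfold-reverse (invLetter l) (map invLetter w)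

invWord-inverseʳ : ∀ {m} (w : Word m) → (w ++ invWord w) ≈ []
invWord-inverseʳ [] = ≈refl
invWord-inverseʳ (l ∷ w) =
  ≈trans (≈-reflexive regroup) (≈trans (≈-cong [ l ] [ invLetter l ] (invWord-inverseʳ w)) (cancel l))
  where
  cancel : ∀ l → (l ∷ invLetter l ∷ []) ≈ []
  cancel (gen a) = step [] [] (cancel-l a)
  cancel (inv a) = step [] [] (cancel-r a)
  regroup : (l ∷ w) ++ invWord (l ∷ w) ≡ [ l ] ++ (w ++ invWord w) ++ [ invLetter l ]
  regroup = trans (cong (λ z → l ∷ w ++ z) (invWord-∷ l w)) (cong (l ∷_) (sym (++-assoc w (invWord w) _)))

-- Throughout, the braid group has m = m' + 1 generators (n = m + 1 ≥ 2
-- strands), and the index j stands for the generator x_{j+1}.  Indices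
-- ≥ m never occur in the words we use; ι sends them to an arbitrary letter.

module Indexed (m' : ℕ) where

  m : ℕ
  m = suc m'

  ι : ℕ → Fin m
  ι k with k <? m
  ... | yes p = fromℕ< p
  ... | no _ = fzero

  toℕ-ι : ∀ {k} → k < m → toℕ (ι k) ≡ k
  toℕ-ι {k} p with k <? m
  ... | yes q = toℕ-fromℕ< q
  ... | no ¬q = ⊥-elim (¬q p)

  ι-toℕ : (x : Fin m) → ι (toℕ x) ≡ x
  ι-toℕ x = toℕ-injective (toℕ-ι (toℕ<n x))

  W : List ℕ → Word m
  W Z = pos (map ι Z)

  W-++ : (X Y : List ℕ) → W (X ++ Y) ≡ W X ++ W Y
  W-++ X Y = trans (cong (map gen) (map-++ ι X Y)) (map-++ gen (map ι X) (map ι Y))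

  -- Equality in B_n of the positive words of two index lists (a record, so
  -- that the index lists can be inferred from a proof).
  infix 4 _≈ₚ_
  record _≈ₚ_ (u v : List ℕ) : Set where
    constructor ⟪_⟫
    field un : W u ≈ W v
  open _≈ₚ_ public

  ≈ₚ-refl : ∀ {u} → u ≈ₚ u
  ≈ₚ-refl = ⟪ ≈refl ⟫

  ≈ₚ-reflexive : ∀ {u v} → u ≡ v → u ≈ₚ v
  ≈ₚ-reflexive refl = ≈ₚ-refl

  ≈ₚ-sym : ∀ {u v} → u ≈ₚ v → v ≈ₚ u
  ≈ₚ-sym ⟪ p ⟫ = ⟪ ≈sym p ⟫

  ≈ₚ-trans : ∀ {u v w} → u ≈ₚ v → v ≈ₚ w → u ≈ₚ w
  ≈ₚ-trans ⟪ p ⟫ ⟪ q ⟫ = ⟪ ≈trans p q ⟫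

  module ≈ₚ-Reasoning where
    infixr 2 _≈⟨_⟩_ _≡⟨_⟩_
    infix 3 _∎
    _≈⟨_⟩_ : ∀ x {y z} → x ≈ₚ y → y ≈ₚ z → x ≈ₚ z
    x ≈⟨ p ⟩ q = ≈ₚ-trans p q
    _≡⟨_⟩_ : ∀ x {y z} → x ≡ y → y ≈ₚ z → x ≈ₚ z
    x ≡⟨ refl ⟩ q = q
    _∎ : ∀ x → x ≈ₚ x
    x ∎ = ≈ₚ-refl
  open ≈ₚ-Reasoning

  ≈ₚ-cong : ∀ {u v} (p s : List ℕ) → u ≈ₚ v → (p ++ u ++ s) ≈ₚ (p ++ v ++ s)
  ≈ₚ-cong {u} {v} p s ⟪ q ⟫ = ⟪ subst₂ _≈_ (W-split u) (W-split v) (≈-cong (W p) (W s) q) ⟫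
    where
    W-split : ∀ x → W p ++ W x ++ W s ≡ W (p ++ x ++ s)
    W-split x = sym (trans (W-++ p (x ++ s)) (cong (W p ++_) (W-++ x s)))

  ≈ₚ-congˡ : ∀ {u v} (p : List ℕ) → u ≈ₚ v → (p ++ u) ≈ₚ (p ++ v)
  ≈ₚ-congˡ {u} {v} p q = subst₂ _≈ₚ_ (drop-[] u) (drop-[] v) (≈ₚ-cong p [] q)
    where
    drop-[] : ∀ x → p ++ x ++ [] ≡ p ++ x
    drop-[] x = cong (p ++_) (++-identityʳ x)

  ≈ₚ-congʳ : ∀ {u v} (s : List ℕ) → u ≈ₚ v → (u ++ s) ≈ₚ (v ++ s)
  ≈ₚ-congʳ s q = ≈ₚ-cong [] s q

  Far : ℕ → ℕ → Set
  Far a b = suc (suc a) ≤ b ⊎ suc (suc b) ≤ a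

  commute₂ : ∀ {a b} → a < m → b < m → Far a b → (a ∷ b ∷ []) ≈ₚ (b ∷ a ∷ [])
  commute₂ {a} {b} am bm (inj₁ h) = ⟪ step [] [] (commute (ι a) (ι b) (far-ι am bm h)) ⟫
    where
    far-ι : ∀ {a b} → a < m → b < m → suc (suc a) ≤ b → suc (suc (toℕ (ι a))) ≤ toℕ (ι b)
    far-ι am bm = subst₂ (λ x y → suc (suc x) ≤ y) (sym (toℕ-ι am)) (sym (toℕ-ι bm))
  commute₂ am bm (inj₂ h) = ≈ₚ-sym (commute₂ bm am (inj₁ h))

  braid₃ : ∀ {a} → suc a < m → (a ∷ suc a ∷ a ∷ []) ≈ₚ (suc a ∷ a ∷ suc a ∷ [])
  braid₃ {a} h = ⟪ step [] [] (braid (ι a) (ι (suc a)) adjacent) ⟫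
    where
    adjacent : toℕ (ι (suc a)) ≡ suc (toℕ (ι a))
    adjacent = trans (toℕ-ι h) (cong suc (sym (toℕ-ι (<-trans (n<1+n a) h))))

  commute-past : ∀ {a} B → a < m → All (_< m) B → All (Far a) B → (a ∷ B) ≈ₚ (B ++ [ a ])
  commute-past [] am _ _ = ≈ₚ-refl
  commute-past {a} (b ∷ B) am (bm ∷ Bm) (f ∷ fs) =
    (a ∷ b ∷ B) ≈⟨ ≈ₚ-congʳ B (commute₂ am bm f) ⟩
    (b ∷ a ∷ B) ≈⟨ ≈ₚ-congˡ [ b ] (commute-past B am Bm fs) ⟩
    (b ∷ B ++ [ a ]) ∎

  commute-words : ∀ A B → All (_< m) A → All (_< m) B → All (λ a → All (Far a) B) A → (A ++ B) ≈ₚ (B ++ A)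
  commute-words [] B _ _ _ = ≈ₚ-reflexive (sym (++-identityʳ B))
  commute-words (a ∷ A) B (am ∷ Am) Bm (f ∷ fs) =
    (a ∷ A ++ B) ≈⟨ ≈ₚ-congˡ [ a ] (commute-words A B Am Bm fs) ⟩
    (a ∷ B ++ A) ≈⟨ ≈ₚ-congʳ A (commute-past B am Bm f) ⟩
    ((B ++ [ a ]) ++ A) ≡⟨ ++-assoc B [ a ] A ⟩
    (B ++ a ∷ A) ∎

-- Runs of consecutive indices and Garside elements

run : ℕ → ℕ → List ℕ
run s zero = []
run s (suc L) = s ∷ run (suc s) L

run-all : ∀ s L {Q : ℕ → Set} → (∀ {x} → s ≤ x → x < s + L → Q x) → All Q (run s L)
run-all s zero f = []
run-all s (suc L) {Q} f = f ≤-refl (m<m+n s (s≤s z≤n)) ∷ run-all (suc s) L shifted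
  where
  shifted : ∀ {x} → suc s ≤ x → x < suc s + L → Q x
  shifted {x} a b = f (≤-trans (n≤1+n s) a) (subst (x <_) (sym (+-suc s L)) b)

run-∷ʳ : ∀ s L → run s L ++ [ s + L ] ≡ run s (suc L)
run-∷ʳ s zero = cong (_∷ []) (+-identityʳ s)
run-∷ʳ s (suc L) = cong (s ∷_) (trans (cong (λ z → run (suc s) L ++ [ z ]) (+-suc s L)) (run-∷ʳ (suc s) L))

map-suc-run : ∀ s L → map suc (run s L) ≡ run (suc s) L
map-suc-run s zero = refl
map-suc-run s (suc L) = cong (suc s ∷_) (map-suc-run (suc s) L)

run-increasing : ∀ s L → AllPairs _<_ (run s L)
run-increasing s zero = []
run-increasing s (suc L) = run-all (suc s) L (λ a _ → a) ∷ run-increasing (suc s) L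

-- Δ t r = run t r ++ run t (r-1) ++ ⋯ ++ run t 1 is the Garside element
-- (half twist) of the subgroup generated by x_{t+1}, …, x_{t+r}.
Δ : ℕ → ℕ → List ℕ
Δ t zero = []
Δ t (suc r) = run t (suc r) ++ Δ t r

Δ-all : ∀ t r → All (λ q → t ≤ q × q < t + r) (Δ t r)
Δ-all t zero = []
Δ-all t (suc r) = AllP.++⁺ (run-all t (suc r) _,_)
  (Amap (λ { (a , b) → a , ≤-trans b (+-monoʳ-≤ t (n≤1+n r)) }) (Δ-all t r))

-- The index sent to j by conjugation with Δ t r: the reflection j ↦ 2t + r - 1 - j.
mirror : ℕ → ℕ → ℕ → ℕ
mirror t r j = (t + t + r) ∸ suc j

mirror-run : ∀ C a L b → b + L + a ≡ C → map (λ j → C ∸ suc j) (run a L) ↭ run b L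
mirror-run C a zero b e = ↭-refl
mirror-run C a (suc L) b e =
  ↭-trans (↭-prep _ (mirror-run C (suc a) L b e'))
    (subst (λ w → w ∷ run b L ↭ run b (suc L)) (sym head)
      (subst (λ z → (b + L) ∷ run b L ↭ z) (run-∷ʳ b L) (PermP.∷↭∷ʳ (b + L) (run b L))))
  where
  shift : ∀ b L a → b + L + suc a ≡ b + suc L + a
  shift = solve-∀
  e' : b + L + suc a ≡ C
  e' = trans (shift b L a) e
  head : C ∸ suc a ≡ b + L
  head = trans (cong (_∸ suc a) (sym e')) (m+n∸n≡m (b + L) (suc a))

mirror-two-runs : ∀ s x y → map (mirror s (suc (x + y))) (run s x ++ run (suc (s + x)) y) ↭ run s y ++ run (suc (s + y)) x
mirror-two-runs s x y = ↭-trans (↭-reflexive (map-++ (mirror s r) (run s x) _))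
  (↭-trans (PermP.++⁺ (mirror-run (s + s + r) s x (suc (s + y)) (first s x y)) (mirror-run (s + s + r) (suc (s + x)) y s (second s x y)))
           (PermP.++-comm (run (suc (s + y)) x) (run s y)))
  where
  r : ℕ
  r = suc (x + y)
  first : ∀ s x y → suc (s + y) + x + s ≡ s + s + suc (x + y)
  first = solve-∀
  second : ∀ s x y → s + y + suc (s + x) ≡ s + s + suc (x + y)
  second = solve-∀

module Garside (m' : ℕ) where
  open Indexed m'
  open ≈ₚ-Reasoning

  run-shift : ∀ t L j → t ≤ j → suc (suc j) ≤ t + L → t + L ≤ m → (run t L ++ [ j ]) ≈ₚ (suc j ∷ run t L)
  run-shift t zero j tj h _ = ⊥-elim (<⇒≱ (≤-trans (s≤s (n≤1+n j)) (subst (_ ≤_) (+-identityʳ t) h)) tj)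
  run-shift t (suc L) j tj h hm with m≤n⇒m<n∨m≡n tj
  ... | inj₁ t<j =
    (t ∷ run (suc t) L ++ [ j ]) ≈⟨ ≈ₚ-congˡ [ t ] (run-shift (suc t) L j t<j (≤-trans h (≤-reflexive (+-suc t L))) hm') ⟩
    (t ∷ suc j ∷ run (suc t) L) ≈⟨ ≈ₚ-congʳ (run (suc t) L) (commute₂ tm jm (inj₁ (s≤s t<j))) ⟩
    (suc j ∷ t ∷ run (suc t) L) ∎
    where
    hm' : suc t + L ≤ m
    hm' = ≤-trans (≤-reflexive (sym (+-suc t L))) hm
    tm : t < m
    tm = <-≤-trans (m<m+n t (s≤s z≤n)) hm
    jm : suc j < m
    jm = <-≤-trans (n<1+n (suc j)) (≤-trans h hm)
  ... | inj₂ refl = braid-case L h hm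
    where
    -- j = t: move x_{t+1} to the front of the run and apply the braid relation.
    braid-case : ∀ L → suc (suc t) ≤ t + suc L → t + suc L ≤ m → (run t (suc L) ++ [ t ]) ≈ₚ (suc t ∷ run t (suc L))
    braid-case zero h _ = ⊥-elim (1+n≰n (≤-trans h (≤-reflexive (trans (+-suc t 0) (cong suc (+-identityʳ t))))))
    braid-case (suc L) _ hm =
      (t ∷ suc t ∷ rest ++ [ t ]) ≈⟨ ≈ₚ-congˡ (t ∷ suc t ∷ []) (≈ₚ-sym (commute-past rest tm rest<m rest-far)) ⟩
      (t ∷ suc t ∷ t ∷ rest) ≈⟨ ≈ₚ-congʳ rest (braid₃ st<m) ⟩
      (suc t ∷ t ∷ suc t ∷ rest) ∎
      where
      rest : List ℕ
      rest = run (suc (suc t)) L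
      end : t + suc (suc L) ≡ suc (suc t) + L
      end = trans (+-suc t (suc L)) (cong suc (+-suc t L))
      st<m : suc t < m
      st<m = ≤-trans (s≤s (s≤s (m≤m+n t L))) (≤-trans (≤-reflexive (sym end)) hm)
      tm : t < m
      tm = <-≤-trans (m<m+n t (s≤s z≤n)) hm
      rest<m : All (_< m) rest
      rest<m = run-all (suc (suc t)) L (λ _ b → <-≤-trans b (≤-trans (≤-reflexive (sym end)) hm))
      rest-far : All (Far t) rest
      rest-far = run-all (suc (suc t)) L (λ a _ → inj₁ a)

  run-shift* : ∀ t L u → All (λ j → t ≤ j × suc (suc j) ≤ t + L) u → t + L ≤ m → (run t L ++ u) ≈ₚ (map suc u ++ run t L)
  run-shift* t L [] _ _ = ≈ₚ-reflexive (++-identityʳ (run t L))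
  run-shift* t L (j ∷ u) ((a , b) ∷ hs) hm =
    (run t L ++ j ∷ u) ≡⟨ sym (++-assoc (run t L) [ j ] u) ⟩
    ((run t L ++ [ j ]) ++ u) ≈⟨ ≈ₚ-congʳ u (run-shift t L j a b hm) ⟩
    (suc j ∷ run t L ++ u) ≈⟨ ≈ₚ-congˡ [ suc j ] (run-shift* t L u hs hm) ⟩
    (suc j ∷ map suc u ++ run t L) ∎

  Δ-flip-top : ∀ t r → t + r < m → (Δ t (suc r) ++ [ t + r ]) ≈ₚ (t ∷ Δ t (suc r))
  Δ-flip-top t zero _ = ≈ₚ-reflexive (cong (λ z → t ∷ z ∷ []) (+-identityʳ t))
  Δ-flip-top t (suc r) hm = ≈ₚ-trans absorb-top (≈ₚ-sym absorb-bottom)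
    where
    x : ℕ
    x = t + suc r
    R₂ : List ℕ
    R₂ = run t (suc (suc r))
    R₁ : List ℕ
    R₁ = run t (suc r)
    target : List ℕ
    target = R₂ ++ R₂ ++ Δ t r
    hm' : t + suc (suc r) ≤ m
    hm' = ≤-trans (≤-reflexive (+-suc t (suc r))) hm
    Δ<m : All (_< m) (Δ t r)
    Δ<m = Amap (λ { (a , b) → <-≤-trans b (≤-trans (+-monoʳ-≤ t (≤-trans (n≤1+n r) (n≤1+n (suc r)))) hm') }) (Δ-all t r)
    Δ-far : All (Far x) (Δ t r)
    Δ-far = Amap (λ { (a , b) → inj₂ (≤-trans (s≤s b) (≤-reflexive (sym (+-suc t r)))) }) (Δ-all t r)
    -- The letter x = t + r + 1 commutes with Δ t r and completes R₁ to R₂.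
    absorb-top : ((R₂ ++ R₁ ++ Δ t r) ++ [ x ]) ≈ₚ target
    absorb-top =
      ((R₂ ++ R₁ ++ Δ t r) ++ [ x ]) ≡⟨ trans (++-assoc R₂ _ _) (cong (R₂ ++_) (++-assoc R₁ _ _)) ⟩
      (R₂ ++ R₁ ++ Δ t r ++ [ x ]) ≡⟨ sym (++-assoc R₂ R₁ _) ⟩
      ((R₂ ++ R₁) ++ Δ t r ++ [ x ]) ≈⟨ ≈ₚ-congˡ (R₂ ++ R₁) (≈ₚ-sym (commute-past (Δ t r) hm Δ<m Δ-far)) ⟩
      ((R₂ ++ R₁) ++ x ∷ Δ t r) ≡⟨ trans (++-assoc R₂ _ _) (cong (R₂ ++_) (trans (sym (++-assoc R₁ [ x ] _)) (cong (_++ Δ t r) (run-∷ʳ t (suc r))))) ⟩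
      target ∎
    -- R₂ R₁ = (run (t+1) (r+1)) R₂, and x_{t+1} completes run (t+1) (r+1) to R₂.
    absorb-bottom : (t ∷ R₂ ++ R₁ ++ Δ t r) ≈ₚ target
    absorb-bottom =
      (t ∷ R₂ ++ R₁ ++ Δ t r) ≡⟨ cong (t ∷_) (sym (++-assoc R₂ _ _)) ⟩
      (t ∷ (R₂ ++ R₁) ++ Δ t r) ≈⟨ ≈ₚ-congˡ [ t ] (≈ₚ-congʳ (Δ t r) (run-shift* t (suc (suc r)) R₁ R₁-inside hm')) ⟩
      (t ∷ (map suc R₁ ++ R₂) ++ Δ t r) ≡⟨ cong (λ z → t ∷ (z ++ R₂) ++ Δ t r) (map-suc-run t (suc r)) ⟩
      (t ∷ (run (suc t) (suc r) ++ R₂) ++ Δ t r) ≡⟨ cong (t ∷_) (++-assoc (run (suc t) (suc r)) _ _) ⟩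
      target ∎
      where
      R₁-inside : All (λ j → t ≤ j × suc (suc j) ≤ t + suc (suc r)) R₁
      R₁-inside = run-all t (suc r) (λ a b → a , ≤-trans (s≤s b) (≤-reflexive (sym (+-suc t (suc r)))))

  Δ-flip : ∀ t r j j' → t ≤ j → j < t + r → suc (j + j') ≡ t + t + r → t + r ≤ m → (Δ t r ++ [ j ]) ≈ₚ (j' ∷ Δ t r)
  Δ-flip t zero j j' tj jr e hm = ⊥-elim (<⇒≱ jr (≤-trans (≤-reflexive (+-identityʳ t)) tj))
  Δ-flip t (suc r) j j' tj jr e hm with m≤n⇒m<n∨m≡n (≤-pred (≤-trans jr (≤-reflexive (+-suc t r))))
  ... | inj₂ refl = subst (λ z → (Δ t (suc r) ++ [ t + r ]) ≈ₚ (z ∷ Δ t (suc r))) j'≡t (Δ-flip-top t r (<-≤-trans (+-monoʳ-< t (n<1+n r)) hm))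
    where
    top-sum : ∀ t r → t + t + suc r ≡ suc ((t + r) + t)
    top-sum = solve-∀
    j'≡t : t ≡ j'
    j'≡t = sym (+-cancelˡ-≡ (t + r) j' t (suc-injective (trans e (top-sum t r))))
  ... | inj₁ j<tr = inner j' e
    where
    inner : ∀ j' → suc (j + j') ≡ t + t + suc r → (Δ t (suc r) ++ [ j ]) ≈ₚ (j' ∷ Δ t (suc r))
    inner zero e = ⊥-elim (<⇒≱ j<tr (≤-trans (m≤n+m (t + r) t) (≤-reflexive (sym j-top))))
      where
      j-top : j ≡ t + (t + r)
      j-top = trans (suc-injective (trans (trans (cong suc (sym (+-identityʳ j))) e) (+-suc (t + t) r))) (+-assoc t t r)
    inner (suc j'') e =
      ((R ++ Δ t r) ++ [ j ]) ≡⟨ ++-assoc R (Δ t r) [ j ] ⟩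
      (R ++ Δ t r ++ [ j ]) ≈⟨ ≈ₚ-congˡ R (Δ-flip t r j j'' tj j<tr e' (≤-trans (+-monoʳ-≤ t (n≤1+n r)) hm)) ⟩
      (R ++ j'' ∷ Δ t r) ≡⟨ sym (++-assoc R [ j'' ] (Δ t r)) ⟩
      ((R ++ [ j'' ]) ++ Δ t r) ≈⟨ ≈ₚ-congʳ (Δ t r) (run-shift t (suc r) j'' t≤j'' j''-inside hm) ⟩
      (suc j'' ∷ R ++ Δ t r) ∎
      where
      R : List ℕ
      R = run t (suc r)
      e' : suc (j + j'') ≡ t + t + r
      e' = suc-injective (trans (trans (cong suc (sym (+-suc j j''))) e) (+-suc (t + t) r))
      t≤j'' : t ≤ j''
      t≤j'' = +-cancelʳ-≤ (suc j) t j'' (≤-trans (+-monoʳ-≤ t j<tr) (≤-reflexive (sym (trans (trans (+-comm j'' (suc j)) e') (+-assoc t t r)))))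
      j''-inside : suc (suc j'') ≤ t + suc r
      j''-inside = ≤-trans (s≤s (+-cancelʳ-≤ j (suc j'') (t + r) (≤-trans (≤-reflexive (trans (cong suc (+-comm j'' j)) e')) (≤-trans (≤-reflexive (trans (+-assoc t t r) (+-comm t (t + r)))) (+-monoʳ-≤ (t + r) tj))))) (≤-reflexive (sym (+-suc t r)))

  Δ-flip* : ∀ t r u → All (λ j → t ≤ j × j < t + r) u → t + r ≤ m → (Δ t r ++ u) ≈ₚ (map (mirror t r) u ++ Δ t r)
  Δ-flip* t r [] _ _ = ≈ₚ-reflexive (++-identityʳ (Δ t r))
  Δ-flip* t r (j ∷ u) ((a , b) ∷ hs) hm =
    (Δ t r ++ j ∷ u) ≡⟨ sym (++-assoc (Δ t r) [ j ] u) ⟩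
    ((Δ t r ++ [ j ]) ++ u) ≈⟨ ≈ₚ-congʳ u (Δ-flip t r j (mirror t r j) a b mirror-sum hm) ⟩
    (mirror t r j ∷ Δ t r ++ u) ≈⟨ ≈ₚ-congˡ [ mirror t r j ] (Δ-flip* t r u hs hm) ⟩
    (mirror t r j ∷ map (mirror t r) u ++ Δ t r) ∎
    where
    mirror-sum : suc (j + mirror t r j) ≡ t + t + r
    mirror-sum = m+[n∸m]≡n (≤-trans b (+-monoˡ-≤ r (m≤n+m t t)))

AllPairs-∷ʳ⁻ : ∀ (xs : List ℕ) z → AllPairs _<_ (xs ++ [ z ]) → AllPairs _<_ xs × All (_< z) xs
AllPairs-∷ʳ⁻ [] z _ = [] , []
AllPairs-∷ʳ⁻ (x ∷ xs) z (a ∷ p) with AllPairs-∷ʳ⁻ xs z p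
... | p₁ , p₂ = AllP.++⁻ˡ xs a ∷ p₁ , last (AllP.++⁻ʳ xs a) ∷ p₂
  where
  last : ∀ {P : ℕ → Set} {z} → All P [ z ] → P z
  last (p ∷ []) = p

length-∷ʳ : ∀ (xs : List ℕ) z → length (xs ++ [ z ]) ≡ suc (length xs)
length-∷ʳ xs z = trans (length-++ xs) (+-comm (length xs) 1)

-- Conjugation by positive words

module Conjugation (m' : ℕ) where
  open Indexed m'
  open ≈ₚ-Reasoning
  open Garside m'

  -- Keeping track of Q lets us transport a
  -- conjugation into a context of letters that commute with g.
  PosConj : (ℕ → Set) → List ℕ → List ℕ → Set
  PosConj Q u v = Σ (List ℕ) λ g → All Q g × (g ++ u) ≈ₚ (v ++ g)

  PosConj-refl : ∀ {Q u} → PosConj Q u u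
  PosConj-refl {u = u} = [] , [] , ≈ₚ-reflexive (sym (++-identityʳ u))

  PosConj-trans : ∀ {Q u v w} → PosConj Q u v → PosConj Q v w → PosConj Q u w
  PosConj-trans {u = u} {v} {w} (g₁ , Q₁ , p₁) (g₂ , Q₂ , p₂) = (g₂ ++ g₁) , AllP.++⁺ Q₂ Q₁ ,
    ((g₂ ++ g₁) ++ u ≡⟨ ++-assoc g₂ g₁ u ⟩
    g₂ ++ g₁ ++ u ≈⟨ ≈ₚ-congˡ g₂ p₁ ⟩
    g₂ ++ v ++ g₁ ≡⟨ sym (++-assoc g₂ v g₁) ⟩
    (g₂ ++ v) ++ g₁ ≈⟨ ≈ₚ-congʳ g₁ p₂ ⟩
    (w ++ g₂) ++ g₁ ≡⟨ ++-assoc w g₂ g₁ ⟩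
    w ++ g₂ ++ g₁ ∎)

  PosConj-mono : ∀ {Q Q' : ℕ → Set} {u v} → (∀ {x} → Q x → Q' x) → PosConj Q u v → PosConj Q' u v
  PosConj-mono f (g , a , p) = g , Amap f a , p

  PosConj-frame : ∀ {Q u v} pre suf → All (_< m) pre → All (_< m) suf →
                  (∀ {q} → Q q → q < m × All (Far q) pre × All (Far q) suf) →
                  PosConj Q u v → PosConj Q (pre ++ u ++ suf) (pre ++ v ++ suf)
  PosConj-frame {Q} {u} {v} pre suf pre<m suf<m far (g , a , p) = g , a ,
    (g ++ pre ++ u ++ suf ≡⟨ sym (++-assoc g pre _) ⟩
    (g ++ pre) ++ u ++ suf ≈⟨ ≈ₚ-congʳ (u ++ suf) (commute-words g pre g<m pre<m (Amap (λ z → proj₁ (proj₂ (far z))) a)) ⟩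
    (pre ++ g) ++ u ++ suf ≡⟨ trans (++-assoc pre g _) (cong (pre ++_) (sym (++-assoc g u suf))) ⟩
    pre ++ (g ++ u) ++ suf ≈⟨ ≈ₚ-cong pre suf p ⟩
    pre ++ (v ++ g) ++ suf ≡⟨ trans (cong (pre ++_) (++-assoc v g suf)) (sym (++-assoc pre v _)) ⟩
    (pre ++ v) ++ g ++ suf ≈⟨ ≈ₚ-congˡ (pre ++ v) (commute-words g suf g<m suf<m (Amap (λ z → proj₂ (proj₂ (far z))) a)) ⟩
    (pre ++ v) ++ suf ++ g ≡⟨ trans (++-assoc pre v _) (cong (pre ++_) (sym (++-assoc v suf g))) ⟩
    pre ++ (v ++ suf) ++ g ≡⟨ sym (++-assoc pre _ g) ⟩
    (pre ++ v ++ suf) ++ g ∎)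
    where
    g<m : All (_< m) g
    g<m = Amap (λ z → proj₁ (far z)) a

  cycle-conj : ∀ {Q} X D T → All Q D → All (_< m) D → All (_< m) T → All (λ d → All (Far d) T) D →
               PosConj Q (X ++ D ++ T) (D ++ X ++ T)
  cycle-conj X D T QD D<m T<m far = D , QD ,
    (D ++ X ++ D ++ T ≡⟨ sym (++-assoc D X _) ⟩
    (D ++ X) ++ D ++ T ≈⟨ ≈ₚ-congˡ (D ++ X) (commute-words D T D<m T<m far) ⟩
    (D ++ X) ++ T ++ D ≡⟨ trans (sym (++-assoc (D ++ X) T D)) (cong (_++ D) (++-assoc D X T)) ⟩
    (D ++ X ++ T) ++ D ∎)

  -- We move the
  -- largest letter z of v to the end (conjugating by the letters after it)
  -- and recurse on the rest; the fuel N = length Z bounds the recursion.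
  sort-conj : ∀ N (Q : ℕ → Set) v Z T → length Z ≡ N → AllPairs _<_ Z → v ↭ Z →
              All (λ x → All (x <_) T) v → All Q v → All (_< m) v → All (_< m) T → PosConj Q (v ++ T) (Z ++ T)
  sort-conj N Q v Z T len Z↑ v↭Z v<T Qv v<m T<m with initLast Z
  sort-conj N Q v Z T len Z↑ v↭Z v<T Qv v<m T<m | [] with PermP.↭-empty-inv v↭Z
  ... | refl = PosConj-refl
  sort-conj zero Q v Z T len Z↑ v↭Z v<T Qv v<m T<m | Z' ∷ʳ′ z = ⊥-elim (1+n≢0 (trans (sym (length-∷ʳ Z' z)) len))
  sort-conj (suc N) Q v Z T len Z↑ v↭Z v<T Qv v<m T<m | Z' ∷ʳ′ z
    with ∈-∃++ (PermP.∈-resp-↭ (↭-sym v↭Z) (∈-++⁺ʳ Z' (here refl)))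
  ... | C , D , refl = PosConj-trans move-z (subst (PosConj Q ((D ++ C) ++ z ∷ T)) (sym (++-assoc Z' [ z ] T)) rest)
    where
    DC↭Z' : D ++ C ↭ Z'
    DC↭Z' = ↭-trans (PermP.++-comm D C) (PermP.drop-∷ (↭-trans (↭-sym (PermP.shift z C D)) (↭-trans v↭Z (↭-sym (PermP.∷↭∷ʳ z Z')))))
    Z'↑ : AllPairs _<_ Z'
    Z'↑ = proj₁ (AllPairs-∷ʳ⁻ Z' z Z↑)
    DC<z : All (_< z) (D ++ C)
    DC<z = PermP.All-resp-↭ (↭-sym DC↭Z') (proj₂ (AllPairs-∷ʳ⁻ Z' z Z↑))
    onC : ∀ {P : ℕ → Set} → All P (C ++ z ∷ D) → All P C
    onC = AllP.++⁻ˡ C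
    onz : ∀ {P : ℕ → Set} → All P (C ++ z ∷ D) → P z
    onz a with AllP.++⁻ʳ C a
    ... | pz ∷ _ = pz
    onD : ∀ {P : ℕ → Set} → All P (C ++ z ∷ D) → All P D
    onD a with AllP.++⁻ʳ C a
    ... | _ ∷ pD = pD
    move-z : PosConj Q ((C ++ z ∷ D) ++ T) ((D ++ C) ++ z ∷ T)
    move-z = subst₂ (PosConj Q) (trans (++-assoc C [ z ] (D ++ T)) (sym (++-assoc C (z ∷ D) T)))
                                (trans (cong (D ++_) (++-assoc C [ z ] T)) (sym (++-assoc D C (z ∷ T))))
      (cycle-conj (C ++ [ z ]) D T (onD Qv) (onD v<m) T<m
        (Amap (λ d<z → Amap (λ z<t → inj₁ (≤-trans (s≤s d<z) z<t)) (onz v<T)) (AllP.++⁻ˡ D DC<z)))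
    rest : PosConj Q ((D ++ C) ++ z ∷ T) (Z' ++ z ∷ T)
    rest = sort-conj N Q (D ++ C) Z' (z ∷ T)
      (suc-injective (trans (sym (length-∷ʳ Z' z)) len)) Z'↑ DC↭Z'
      (AllP.++⁺ (zipWith (λ { (a , b) → a ∷ b }) (AllP.++⁻ˡ D DC<z , onD v<T))
                (zipWith (λ { (a , b) → a ∷ b }) (AllP.++⁻ʳ D DC<z , onC v<T)))
      (AllP.++⁺ (onD Qv) (onC Qv)) (AllP.++⁺ (onD v<m) (onC v<m)) (onz v<m ∷ T<m)

  sort-into : ∀ {Q} v Z → v ↭ Z → AllPairs _<_ Z → All Q Z → All (_< m) Z → PosConj Q v Z
  sort-into {Q} v Z v↭Z Z↑ QZ Z<m = subst₂ (PosConj Q) (++-identityʳ v) (++-identityʳ Z)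
    (sort-conj (length Z) Q v Z [] refl Z↑ v↭Z (Amap (λ _ → []) v<m) (PermP.All-resp-↭ (↭-sym v↭Z) QZ) v<m [])
    where
    v<m : All (_< m) v
    v<m = PermP.All-resp-↭ (↭-sym v↭Z) Z<m

  Within : ℕ → ℕ → ℕ → Set
  Within s e q = s ≤ q × q ≤ e × q < m

  -- Two adjacent runs, of lengths x and y and separated by a gap, can be
  -- swapped by a conjugation inside the interval they occupy: conjugating by
  -- the Garside element of the interval mirrors both runs, and sorting the
  -- mirrored word yields the swapped runs.
  swap-runs : ∀ s x y → s + x + y < m →
              PosConj (Within s (s + x + y)) (run s x ++ run (suc (s + x)) y) (run s y ++ run (suc (s + y)) x)
  swap-runs s x y hm = PosConj-trans reflect
    (sort-into (map (mirror s r) u) Z (mirror-two-runs s x y) Z↑ Z-within (Amap (λ q → proj₂ (proj₂ q)) Z-within))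
    where
    Q : ℕ → Set
    Q = Within s (s + x + y)
    r : ℕ
    r = suc (x + y)
    u : List ℕ
    u = run s x ++ run (suc (s + x)) y
    Z : List ℕ
    Z = run s y ++ run (suc (s + y)) x
    s+r : s + r ≡ suc (s + x + y)
    s+r = trans (+-suc s (x + y)) (cong suc (sym (+-assoc s x y)))
    s+r≤m : s + r ≤ m
    s+r≤m = ≤-trans (≤-reflexive s+r) hm
    u-inside : All (λ j → s ≤ j × j < s + r) u
    u-inside = AllP.++⁺
      (run-all s x (λ a b → a , ≤-trans b (≤-trans (m≤m+n (s + x) y) (≤-trans (n≤1+n _) (≤-reflexive (sym s+r))))))
      (run-all (suc (s + x)) y (λ a b → ≤-trans (m≤m+n s x) (≤-trans (n≤1+n _) a)
                                       , ≤-trans b (≤-reflexive (trans (cong suc (+-assoc s x y)) (sym (+-suc s (x + y)))))))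
    reflect : PosConj Q u (map (mirror s r) u)
    reflect = Δ s r , Amap (λ { (a , b) → a , ≤-pred (≤-trans b (≤-reflexive s+r)) , <-≤-trans b s+r≤m }) (Δ-all s r)
                   , Δ-flip* s r u u-inside s+r≤m
    Z-within : All Q Z
    Z-within = AllP.++⁺
      (run-all s y (λ a b → a , ≤-trans (<⇒≤ b) y-end , <-≤-trans b (≤-trans y-end (<⇒≤ hm))))
      (run-all (suc (s + y)) x (λ a b → ≤-trans (m≤m+n s y) (≤-trans (n≤1+n _) a)
                                       , ≤-pred (≤-trans b (≤-reflexive x-end)) , <-≤-trans (≤-trans b (≤-reflexive x-end)) hm))
      where
      x-end : suc (s + y) + x ≡ suc (s + x + y)
      x-end = cong suc (trans (+-assoc s y x) (trans (cong (s +_) (+-comm y x)) (sym (+-assoc s x y))))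
      y-end : s + y ≤ s + x + y
      y-end = +-monoˡ-≤ y (m≤m+n s x)
    Z↑ : AllPairs _<_ Z
    Z↑ = APP.++⁺ (run-increasing s y) (run-increasing (suc (s + y)) x)
      (run-all s y (λ _ b → run-all (suc (s + y)) x (λ a _ → <-≤-trans b (≤-trans (n≤1+n _) a))))

blocks : ℕ → List ℕ → List ℕ
blocks s [] = []
blocks s (c ∷ cs) = run s c ++ blocks (suc (s + c)) cs

span : List ℕ → ℕ
span [] = 0
span (c ∷ cs) = suc c + span cs

span-sum : ∀ cs → span cs ≡ sum cs + length cs
span-sum [] = refl
span-sum (c ∷ cs) = trans (cong (suc c +_) (span-sum cs)) (regroup c (sum cs) (length cs))
  where
  regroup : ∀ c s l → suc c + (s + l) ≡ c + s + suc l
  regroup = solve-∀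

span-↭ : ∀ {cs cs'} → cs ↭ cs' → span cs ≡ span cs'
span-↭ {cs} {cs'} p = trans (span-sum cs) (trans (cong₂ _+_ (sum-↭ p) (PermP.↭-length p)) (sym (span-sum cs')))

blocks-all : ∀ s cs → All (λ q → s ≤ q × suc q < s + span cs) (blocks s cs)
blocks-all s [] = []
blocks-all s (c ∷ cs) = AllP.++⁺
  (run-all s c (λ a b → a , ≤-trans (s≤s b) (≤-trans (≤-reflexive (sym (+-suc s c))) (+-monoʳ-≤ s (m≤m+n (suc c) (span cs))))))
  (Amap (λ { (a , b) → ≤-trans (m≤m+n s c) (≤-trans (n≤1+n _) a) , ≤-trans b (≤-reflexive (next-start s c (span cs))) })
        (blocks-all (suc (s + c)) cs))
  where
  next-start : ∀ s c w → suc (s + c) + w ≡ s + (suc c + w)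
  next-start = solve-∀

module BlockConjugation (m' : ℕ) where
  open Indexed m'
  open Conjugation m'

  From : ℕ → ℕ → Set
  From s q = s ≤ q × q < m

  blocks<m : ∀ s cs → s + span cs ≤ suc m → All (_< m) (blocks s cs)
  blocks<m s cs h = Amap (λ { (a , b) → ≤-pred (≤-trans b h) }) (blocks-all s cs)

  prefix-run : ∀ s x {U V} → s + x ≤ m → PosConj (From (suc (s + x))) U V → PosConj (From s) (run s x ++ U) (run s x ++ V)
  prefix-run s x {U} {V} hx conj = PosConj-mono (λ { (a , b) → ≤-trans (m≤m+n s x) (≤-trans (n≤1+n _) a) , b })
    (subst₂ (PosConj _) (cong (run s x ++_) (++-identityʳ U)) (cong (run s x ++_) (++-identityʳ V))
      (PosConj-frame (run s x) [] (run-all s x (λ _ b → <-≤-trans b hx)) []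
        (λ { (a , b) → b , run-all s x (λ _ c → inj₂ (≤-trans (s≤s c) a)) , [] }) conj))

  swap-blocks : ∀ s x y cs → s + span (x ∷ y ∷ cs) ≤ suc m → PosConj (From s) (blocks s (x ∷ y ∷ cs)) (blocks s (y ∷ x ∷ cs))
  swap-blocks s x y cs hb =
    PosConj-mono (λ { (a , b , c) → a , c })
      (subst₂ (PosConj _) (++-assoc (run s x) _ tail)
                          (trans (++-assoc (run s y) _ tail) (cong (λ z → run s y ++ run (suc (s + y)) x ++ blocks z cs) (tail-start s x y)))
        (PosConj-frame [] tail [] tail<m (λ { (a , b , c) → c , [] , tail-far b }) (swap-runs s x y xy<m)))
    where
    total : ∀ s x y w → s + (suc x + (suc y + w)) ≡ suc (suc (s + x + y + w))
    total = solve-∀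
    tail-start : ∀ s x y → suc (suc (s + x) + y) ≡ suc (suc (s + y) + x)
    tail-start = solve-∀
    tail-span : ∀ s x y w → suc (suc (s + x) + y) + w ≡ suc (suc (s + x + y + w))
    tail-span = solve-∀
    tail : List ℕ
    tail = blocks (suc (suc (s + x) + y)) cs
    xy<m : s + x + y < m
    xy<m = ≤-pred (≤-trans (s≤s (s≤s (m≤m+n (s + x + y) (span cs)))) (≤-trans (≤-reflexive (sym (total s x y (span cs)))) hb))
    tail<m : All (_< m) tail
    tail<m = blocks<m _ cs (≤-trans (≤-reflexive (tail-span s x y (span cs))) (≤-trans (≤-reflexive (sym (total s x y (span cs)))) hb))
    tail-far : ∀ {q} → q ≤ s + x + y → All (Far q) tail
    tail-far {q} hq = Amap (λ { (a , _) → inj₁ (≤-trans (s≤s (s≤s hq)) a) })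
                           (blocks-all _ cs)

  tail-fits : ∀ s c cs → s + span (c ∷ cs) ≤ suc m → suc (s + c) + span cs ≤ suc m
  tail-fits s c cs hb = ≤-trans (≤-reflexive (rest s c (span cs))) hb
    where
    rest : ∀ s c w → suc (s + c) + w ≡ s + (suc c + w)
    rest = solve-∀

  head-fits : ∀ s c cs → s + span (c ∷ cs) ≤ suc m → s + c ≤ m
  head-fits s c cs hb = ≤-pred (≤-trans (≤-reflexive (sym (+-suc s c))) (≤-trans (+-monoʳ-≤ s (m≤m+n (suc c) (span cs))) hb))

  blocks-permute : ∀ s {cs cs'} → cs ↭ cs' → s + span cs ≤ suc m → PosConj (From s) (blocks s cs) (blocks s cs')
  blocks-permute s Perm.refl hb = PosConj-refl
  blocks-permute s (Perm.prep {xs = cs} x p) hb =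
    prefix-run s x (head-fits s x cs hb) (blocks-permute (suc (s + x)) p (tail-fits s x cs hb))
  blocks-permute s (Perm.swap {xs = cs} x y p) hb =
    PosConj-trans (swap-blocks s x y cs hb)
      (prefix-run s y (head-fits s y (x ∷ cs) hb')
        (prefix-run (suc (s + y)) x (head-fits _ x cs hb'')
          (blocks-permute _ p (tail-fits _ x cs hb''))))
    where
    exchange : ∀ s x y w → s + (suc y + (suc x + w)) ≡ s + (suc x + (suc y + w))
    exchange = solve-∀
    hb' : s + span (y ∷ x ∷ cs) ≤ suc m
    hb' = ≤-trans (≤-reflexive (exchange s x y (span cs))) hb
    hb'' : suc (s + y) + span (x ∷ cs) ≤ suc m
    hb'' = tail-fits s y (x ∷ cs) hb'
  blocks-permute s (Perm.trans p q) hb =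
    PosConj-trans (blocks-permute s p hb) (blocks-permute s q (subst (λ w → s + w ≤ suc m) (span-↭ p) hb))

blocks-gap : ∀ s g X → blocks s (replicate g 0 ++ X) ≡ blocks (s + g) X
blocks-gap s zero X = cong (λ z → blocks z X) (sym (+-identityʳ s))
blocks-gap s (suc g) X = trans (blocks-gap (suc (s + 0)) g X)
  (cong (λ z → blocks z X) (trans (cong (λ z → suc z + g) (+-identityʳ s)) (sym (+-suc s g))))

blocks-++ : ∀ s X Y → blocks s (X ++ Y) ≡ blocks s X ++ blocks (s + span X) Y
blocks-++ s [] Y = cong (λ z → blocks z Y) (sym (+-identityʳ s))
blocks-++ s (c ∷ X) Y =
  trans (cong (run s c ++_) (blocks-++ (suc (s + c)) X Y))
    (trans (sym (++-assoc (run s c) _ _)) (cong (λ z → (run s c ++ blocks (suc (s + c)) X) ++ blocks z Y) (next-start s c (span X))))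
  where
  next-start : ∀ s c w → suc (s + c) + w ≡ s + (suc c + w)
  next-start = solve-∀

blocks-trailing-gaps : ∀ s X g → blocks s (X ++ replicate g 0) ≡ blocks s X
blocks-trailing-gaps s X g = trans (blocks-++ s X _) (trans (cong (blocks s X ++_) (no-blocks (s + span X))) (++-identityʳ _))
  where
  no-blocks : ∀ t → blocks t (replicate g 0) ≡ []
  no-blocks t = trans (cong (blocks t) (sym (++-identityʳ (replicate g 0)))) (blocks-gap t g [])

span-gap : ∀ g X → span (replicate g 0 ++ X) ≡ g + span X
span-gap zero X = refl
span-gap (suc g) X = cong suc (span-gap g X)

length-run : ∀ s L → length (run s L) ≡ L
length-run s zero = refl
length-run s (suc L) = cong suc (length-run (suc s) L)

length-blocks : ∀ s cs → length (blocks s cs) ≡ sum cs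
length-blocks s [] = refl
length-blocks s (c ∷ cs) = trans (length-++ (run s c)) (cong₂ _+_ (length-run s c) (length-blocks (suc (s + c)) cs))

blocks-increasing : ∀ s cs → AllPairs _<_ (blocks s cs)
blocks-increasing s [] = []
blocks-increasing s (c ∷ cs) = APP.++⁺ (run-increasing s c) (blocks-increasing (suc (s + c)) cs)
  (run-all s c (λ _ b → Amap (λ { (a , _) → <-≤-trans b (≤-trans (n≤1+n _) a) }) (blocks-all (suc (s + c)) cs)))

-- blocks-after b c Z: the block lengths of run b c ++ Z, where the current
-- run starts at b and has length c so far.
blocks-after : ℕ → ℕ → List ℕ → List ℕ
blocks-after b c [] = c ∷ []
blocks-after b c (z ∷ Z) with z ≟ b + c
... | yes _ = blocks-after b (suc c) Z
... | no _ = c ∷ (replicate (z ∸ suc (b + c)) 0 ++ blocks-after z 1 Z)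

decompose : List ℕ → List ℕ
decompose [] = []
decompose (z ∷ Z) = replicate z 0 ++ blocks-after z 1 Z

Above : ℕ → List ℕ → Set
Above b Z = All (b ≤_) Z × AllPairs _<_ Z

above-next : ∀ z Z → All (z <_) Z → AllPairs _<_ Z → Above (z + 1) Z
above-next z Z a p = Amap (≤-trans (≤-reflexive (+-comm z 1))) a , p

blocks-after-correct : ∀ b c Z → Above (b + c) Z → blocks b (blocks-after b c Z) ≡ run b c ++ Z
blocks-after-correct b c [] _ = refl
blocks-after-correct b c (z ∷ Z) (h ∷ hs , a ∷ p) with z ≟ b + c
... | yes refl = trans (blocks-after-correct b (suc c) Z (Amap (≤-trans (≤-reflexive (+-suc b c))) a , p))
                   (trans (cong (_++ Z) (sym (run-∷ʳ b c))) (++-assoc (run b c) [ b + c ] Z))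
... | no z≢ = cong (run b c ++_) (trans (blocks-gap (suc (b + c)) (z ∸ suc (b + c)) (blocks-after z 1 Z))
                (trans (cong (λ q → blocks q (blocks-after z 1 Z)) (m+[n∸m]≡n after))
                       (blocks-after-correct z 1 Z (above-next z Z a p))))
  where
  after : suc (b + c) ≤ z
  after = ≤∧≢⇒< h (λ e → z≢ (sym e))

decompose-correct : ∀ Z → AllPairs _<_ Z → blocks 0 (decompose Z) ≡ Z
decompose-correct [] _ = refl
decompose-correct (z ∷ Z) (a ∷ p) = trans (blocks-gap 0 z (blocks-after z 1 Z)) (blocks-after-correct z 1 Z (above-next z Z a p))

blocks-after-span : ∀ M b c Z → b + c ≤ M → All (_< M) Z → Above (b + c) Z → b + span (blocks-after b c Z) ≤ suc M
blocks-after-span M b c [] h _ _ = ≤-trans (≤-reflexive (trans (cong (b +_) (+-identityʳ (suc c))) (+-suc b c))) (s≤s h)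
blocks-after-span M b c (z ∷ Z) h (zM ∷ ZM) (hz ∷ hZ , a ∷ p) with z ≟ b + c
... | yes refl = blocks-after-span M b (suc c) Z (≤-trans (≤-reflexive (+-suc b c)) zM) ZM (Amap (≤-trans (≤-reflexive (+-suc b c))) a , p)
... | no z≢ = ≤-trans (≤-reflexive same-end) (blocks-after-span M z 1 Z (≤-trans (≤-reflexive (+-comm z 1)) zM) ZM (above-next z Z a p))
  where
  after : suc (b + c) ≤ z
  after = ≤∧≢⇒< hz (λ e → z≢ (sym e))
  regroup : ∀ b c g w → b + (suc c + (g + w)) ≡ suc (b + c) + g + w
  regroup = solve-∀
  same-end : b + (suc c + span (replicate (z ∸ suc (b + c)) 0 ++ blocks-after z 1 Z)) ≡ z + span (blocks-after z 1 Z)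
  same-end = trans (cong (λ q → b + (suc c + q)) (span-gap (z ∸ suc (b + c)) (blocks-after z 1 Z)))
               (trans (regroup b c (z ∸ suc (b + c)) (span (blocks-after z 1 Z))) (cong (_+ span (blocks-after z 1 Z)) (m+[n∸m]≡n after)))

decompose-span : ∀ M Z → All (_< M) Z → AllPairs _<_ Z → span (decompose Z) ≤ suc M
decompose-span M [] _ _ = z≤n
decompose-span M (z ∷ Z) (zM ∷ ZM) (a ∷ p) = ≤-trans (≤-reflexive (span-gap z (blocks-after z 1 Z)))
  (blocks-after-span M z 1 Z (≤-trans (≤-reflexive (+-comm z 1)) zM) ZM (above-next z Z a p))

sum-gap : ∀ g X → sum (replicate g 0 ++ X) ≡ sum X
sum-gap zero X = refl
sum-gap (suc g) X = sum-gap g X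

blocks-after-sum : ∀ b c Z → sum (blocks-after b c Z) ≡ c + length Z
blocks-after-sum b c [] = refl
blocks-after-sum b c (z ∷ Z) with z ≟ b + c
... | yes _ = trans (blocks-after-sum b (suc c) Z) (sym (+-suc c (length Z)))
... | no _ = cong (c +_) (trans (sum-gap (z ∸ suc (b + c)) (blocks-after z 1 Z)) (blocks-after-sum z 1 Z))

decompose-sum : ∀ Z → sum (decompose Z) ≡ length Z
decompose-sum [] = refl
decompose-sum (z ∷ Z) = trans (sum-gap z (blocks-after z 1 Z)) (blocks-after-sum z 1 Z)

Descending : List ℕ → Set
Descending = AllPairs (λ a b → b ≤ a)

IsPartition : ℕ → ∀ {k} → Vec ℕ k → Set
IsPartition M v = Vec.sum v ≡ M × Descending (toList v) × All (1 ≤_) (toList v)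

nonincPosᵇ-sound : ∀ {k} (v : Vec ℕ k) → T (nonincPosᵇ v) → Descending (toList v) × All (1 ≤_) (toList v)
nonincPosᵇ-sound [] _ = [] , []
nonincPosᵇ-sound (x ∷ []) t = [] ∷ [] , ≤ᵇ⇒≤ 1 x t ∷ []
nonincPosᵇ-sound (x ∷ y ∷ v) t =
  extend (≤ᵇ⇒≤ y x (proj₁ tests)) (nonincPosᵇ-sound (y ∷ v) (proj₂ tests))
  where
  tests : T (y ≤ᵇ x) × T (nonincPosᵇ (y ∷ v))
  tests = Equivalence.to (T-∧ {y ≤ᵇ x} {nonincPosᵇ (y ∷ v)}) t
  extend : y ≤ x → Descending (y ∷ toList v) × All (1 ≤_) (y ∷ toList v) →
           Descending (x ∷ y ∷ toList v) × All (1 ≤_) (x ∷ y ∷ toList v)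
  extend y≤x ((y≥ ∷ desc) , (1≤y ∷ pos)) =
    ((y≤x ∷ Amap (λ q → ≤-trans q y≤x) y≥) ∷ y≥ ∷ desc) , (≤-trans 1≤y y≤x ∷ 1≤y ∷ pos)

nonincPosᵇ-complete : ∀ {k} (v : Vec ℕ k) → Descending (toList v) → All (1 ≤_) (toList v) → T (nonincPosᵇ v)
nonincPosᵇ-complete [] _ _ = tt
nonincPosᵇ-complete (x ∷ []) _ (1≤x ∷ _) = ≤⇒≤ᵇ 1≤x
nonincPosᵇ-complete (x ∷ y ∷ v) ((y≤x ∷ _) ∷ desc) (_ ∷ pos) =
  Equivalence.from T-∧ (≤⇒≤ᵇ y≤x , nonincPosᵇ-complete (y ∷ v) desc pos)

isPartitionᵇ-sound : ∀ M {k} (v : Vec ℕ k) → T (isPartitionᵇ M v) → IsPartition M v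
isPartitionᵇ-sound M v t with Equivalence.to (T-∧ {Vec.sum v ≡ᵇ M} {nonincPosᵇ v}) t
... | sum≡ , shape = ≡ᵇ⇒≡ _ _ sum≡ , nonincPosᵇ-sound v shape

isPartitionᵇ-complete : ∀ M {k} (v : Vec ℕ k) → IsPartition M v → T (isPartitionᵇ M v)
isPartitionᵇ-complete M v (sum≡ , desc , pos) = Equivalence.from T-∧ (≡⇒≡ᵇ _ _ sum≡ , nonincPosᵇ-complete v desc pos)

sum-toList : ∀ {k} (v : Vec ℕ k) → Vec.sum v ≡ sum (toList v)
sum-toList [] = refl
sum-toList (x ∷ v) = cong (x +_) (sum-toList v)

parts≤sum : ∀ xs → All (_≤ sum xs) xs
parts≤sum [] = []
parts≤sum (x ∷ xs) = m≤m+n x (sum xs) ∷ Amap (λ h → ≤-trans h (m≤n+m (sum xs) x)) (parts≤sum xs)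

allVecs-complete : ∀ M k (v : Vec ℕ k) → All (_≤ M) (toList v) → v ∈ allVecs M k
allVecs-complete M zero [] _ = here refl
allVecs-complete M (suc k) (x ∷ v) (x≤M ∷ v≤M) =
  ∈-concatMap⁺ (λ y → map (y ∷_) (allVecs M k)) (Any.map (λ { refl → ∈-map⁺ (x ∷_) (allVecs-complete M k v v≤M) }) (∈-upTo⁺ (s≤s x≤M)))

allVecs-unique : ∀ M k → AllPairs _≢_ (allVecs M k)
allVecs-unique M zero = [] ∷ []
allVecs-unique M (suc k) = concatMap-unique (upTo (suc M)) (APP.applyUpTo⁺₁ id (suc M) (λ i<j _ → i<j))
  where
  cons-injectiveʳ : ∀ {k x y} {u v : Vec ℕ k} → (x ∷ u) ≡ (y ∷ v) → u ≡ v
  cons-injectiveʳ refl = refl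
  cons-injectiveˡ : ∀ {k x y} {u v : Vec ℕ k} → (x ∷ u) ≡ (y ∷ v) → x ≡ y
  cons-injectiveˡ refl = refl
  with-head : ℕ → List (Vec ℕ (suc k))
  with-head x = map (x ∷_) (allVecs M k)
  with-head-unique : ∀ x → AllPairs _≢_ (with-head x)
  with-head-unique x = APP.map⁺ (AllPairs.map (λ u≢v e → u≢v (cons-injectiveʳ e)) (allVecs-unique M k))
  heads-differ : ∀ {x y} → x < y → All (λ u → All (u ≢_) (with-head y)) (with-head x)
  heads-differ x<y = AllP.map⁺ (All.tabulate (λ _ → AllP.map⁺ (All.tabulate (λ _ e → <-irrefl (cons-injectiveˡ e) x<y))))
  concatMap-unique : ∀ xs → AllPairs _<_ xs → AllPairs _≢_ (concatMap with-head xs)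
  concatMap-unique [] _ = []
  concatMap-unique (x ∷ xs) (x< ∷ xs↑) = APP.++⁺ (with-head-unique x) (concatMap-unique xs xs↑) (later xs x<)
    where
    later : ∀ ys → All (x <_) ys → All (λ u → All (u ≢_) (concatMap with-head ys)) (with-head x)
    later [] _ = All.tabulate (λ _ → [])
    later (y ∷ ys) (x<y ∷ x<ys) = zipWith (λ { (a , b) → AllP.++⁺ a b }) (heads-differ x<y , later ys x<ys)

partitions : ∀ M k → List (Vec ℕ k)
partitions M k = filterᵇ (isPartitionᵇ M) (allVecs M k)

partitions-sound : ∀ M k → All (IsPartition M) (partitions M k)
partitions-sound M k = Amap (isPartitionᵇ-sound M _) (AllP.all-filter (T? ∘ isPartitionᵇ M) (allVecs M k))

partitions-unique : ∀ M k → AllPairs _≢_ (partitions M k)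
partitions-unique M k = APP.filter⁺ (T? ∘ isPartitionᵇ M) (allVecs-unique M k)

partitions-complete : ∀ M {k} (v : Vec ℕ k) → IsPartition M v → v ∈ partitions M k
partitions-complete M {k} v p@(sum≡ , _) =
  ∈-filter⁺ (T? ∘ isPartitionᵇ M) (allVecs-complete M k v entries≤M) (isPartitionᵇ-complete M v p)
  where
  entries≤M : All (_≤ M) (toList v)
  entries≤M = subst (λ q → All (_≤ q) (toList v)) (trans (sym (sum-toList v)) sum≡) (parts≤sum (toList v))

pad : (k : ℕ) → List ℕ → Vec ℕ k
pad zero _ = []
pad (suc k) [] = 1 ∷ pad k []
pad (suc k) (x ∷ xs) = x ∷ pad k xs

toList-pad : ∀ k xs → length xs ≤ k → toList (pad k xs) ≡ xs ++ replicate (k ∸ length xs) 1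
toList-pad zero [] _ = refl
toList-pad (suc k) [] _ = cong (1 ∷_) (toList-pad k [] z≤n)
toList-pad (suc k) (x ∷ xs) (s≤s h) = cong (x ∷_) (toList-pad k xs h)

sum-ones : ∀ g → sum (replicate g 1) ≡ g
sum-ones zero = refl
sum-ones (suc g) = cong suc (sum-ones g)

sum-map-suc : ∀ xs → sum (map suc xs) ≡ sum xs + length xs
sum-map-suc [] = refl
sum-map-suc (x ∷ xs) = trans (cong (suc x +_) (sum-map-suc xs)) (regroup x (sum xs) (length xs))
  where
  regroup : ∀ x s l → suc x + (s + l) ≡ x + s + suc l
  regroup = solve-∀

replicate-descending : ∀ g x → Descending (replicate g x)
replicate-descending zero x = []
replicate-descending (suc g) x = AllP.replicate⁺ g ≤-refl ∷ replicate-descending g x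

padded-partition : ∀ i k sd → Descending sd → All (1 ≤_) sd → sum sd ≡ i → length sd ≤ k →
                   IsPartition (i + k) (pad k (map suc sd))
padded-partition i k sd desc pos sum≡ len≤k = total , shape-desc , shape-pos
  where
  r : ℕ
  r = length sd
  len-map : length (map suc sd) ≡ r
  len-map = length-map suc sd
  list≡ : toList (pad k (map suc sd)) ≡ map suc sd ++ replicate (k ∸ r) 1
  list≡ = trans (toList-pad k (map suc sd) (≤-trans (≤-reflexive len-map) len≤k)) (cong (λ l → map suc sd ++ replicate (k ∸ l) 1) len-map)
  total : Vec.sum (pad k (map suc sd)) ≡ i + k
  total = begin
    Vec.sum (pad k (map suc sd))                ≡⟨ trans (sum-toList (pad k (map suc sd))) (cong sum list≡) ⟩
    sum (map suc sd ++ replicate (k ∸ r) 1)     ≡⟨ sum-++ (map suc sd) _ ⟩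
    sum (map suc sd) + sum (replicate (k ∸ r) 1) ≡⟨ cong₂ _+_ (trans (sum-map-suc sd) (cong (_+ r) sum≡)) (sum-ones (k ∸ r)) ⟩
    i + r + (k ∸ r)                            ≡⟨ trans (+-assoc i r _) (cong (i +_) (m+[n∸m]≡n len≤k)) ⟩
    i + k ∎
    where open ≡-Reasoning
  ones-below : All (λ a → All (_≤ a) (replicate (k ∸ r) 1)) (map suc sd)
  ones-below = AllP.map⁺ (All.tabulate {xs = sd} (λ _ → AllP.replicate⁺ _ (s≤s z≤n)))
  shape-desc : Descending (toList (pad k (map suc sd)))
  shape-desc = subst Descending (sym list≡)
    (APP.++⁺ (APP.map⁺ (AllPairs.map s≤s desc)) (replicate-descending (k ∸ r) 1) ones-below)
  shape-pos : All (1 ≤_) (toList (pad k (map suc sd)))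
  shape-pos = subst (All (1 ≤_)) (sym list≡) (AllP.++⁺ (AllP.map⁺ (All.tabulate {xs = sd} (λ _ → s≤s z≤n))) (AllP.replicate⁺ _ ≤-refl))

pred-pad : ∀ k sd → length sd ≤ k → map pred (toList (pad k (map suc sd))) ≡ sd ++ replicate (k ∸ length sd) 0
pred-pad zero [] _ = refl
pred-pad (suc k) [] _ = cong (0 ∷_) (pred-pad k [] z≤n)
pred-pad (suc k) (x ∷ xs) (s≤s h) = cong (x ∷_) (pred-pad k xs h)

module IncSort = Sort ≤-decTotalOrder
module DecSort = Sort ≥-decTotalOrder

sort-increasing : ∀ xs → AllPairs _≢_ xs → AllPairs _<_ (IncSort.sort xs)
sort-increasing xs distinct = AllPairs.zipWith (λ { (le , ne) → ≤∧≢⇒< le ne })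
  (Sorted⇒AllPairs ≤-totalOrder (IncSort.sort-↗ xs) , PermS.Unique-resp-↭ (≡-setoid ℕ) (↭⇒↭ₛ (↭-sym (IncSort.sort-↭ xs))) distinct)

sort-descending : ∀ xs → Descending (DecSort.sort xs)
sort-descending xs = Sorted⇒AllPairs ≥-totalOrder (DecSort.sort-↗ xs)

positives : List ℕ → List ℕ
positives [] = []
positives (zero ∷ cs) = positives cs
positives (suc c ∷ cs) = suc c ∷ positives cs

zero-count : List ℕ → ℕ
zero-count [] = 0
zero-count (zero ∷ cs) = suc (zero-count cs)
zero-count (suc c ∷ cs) = zero-count cs

positives-↭ : ∀ cs → cs ↭ positives cs ++ replicate (zero-count cs) 0
positives-↭ [] = ↭-refl
positives-↭ (zero ∷ cs) = ↭-trans (↭-prep 0 (positives-↭ cs)) (↭-sym (PermP.shift 0 (positives cs) (replicate (zero-count cs) 0)))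
positives-↭ (suc c ∷ cs) = ↭-prep (suc c) (positives-↭ cs)

positives-positive : ∀ cs → All (1 ≤_) (positives cs)
positives-positive [] = []
positives-positive (zero ∷ cs) = positives-positive cs
positives-positive (suc c ∷ cs) = s≤s z≤n ∷ positives-positive cs

sum-positives : ∀ cs → sum (positives cs) ≡ sum cs
sum-positives [] = refl
sum-positives (zero ∷ cs) = sum-positives cs
sum-positives (suc c ∷ cs) = cong (suc c +_) (sum-positives cs)

length-positives≤sum : ∀ cs → length (positives cs) ≤ sum cs
length-positives≤sum [] = z≤n
length-positives≤sum (zero ∷ cs) = length-positives≤sum cs
length-positives≤sum (suc c ∷ cs) = s≤s (≤-trans (length-positives≤sum cs) (m≤n+m (sum cs) c))

length-positives≤length : ∀ cs → length (positives cs) ≤ length cs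
length-positives≤length [] = z≤n
length-positives≤length (zero ∷ cs) = ≤-trans (length-positives≤length cs) (n≤1+n _)
length-positives≤length (suc c ∷ cs) = s≤s (length-positives≤length cs)

-- It is a partition of the length of the word, and it is the cycle
-- type (minus one in each part) of the associated permutation.
shape : List ℕ → List ℕ
shape Z = DecSort.sort (positives (decompose Z))

shape-↭ : ∀ Z → decompose Z ↭ shape Z ++ replicate (zero-count (decompose Z)) 0
shape-↭ Z = ↭-trans (positives-↭ cs) (PermP.++⁺ʳ _ (↭-sym (DecSort.sort-↭ (positives cs))))
  where
  cs : List ℕ
  cs = decompose Z

shape-positive : ∀ Z → All (1 ≤_) (shape Z)
shape-positive Z = PermP.All-resp-↭ (↭-sym (DecSort.sort-↭ _)) (positives-positive (decompose Z))

sum-shape : ∀ Z → sum (shape Z) ≡ length Z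
sum-shape Z = trans (sum-↭ (DecSort.sort-↭ _)) (trans (sum-positives (decompose Z)) (decompose-sum Z))

length-shape : ∀ Z → length (shape Z) ≡ length (positives (decompose Z))
length-shape Z = PermP.↭-length (DecSort.sort-↭ _)

length-shape≤length : ∀ Z → length (shape Z) ≤ length Z
length-shape≤length Z = ≤-trans (≤-reflexive (length-shape Z)) (≤-trans (length-positives≤sum (decompose Z)) (≤-reflexive (decompose-sum Z)))

shape-fits : ∀ M Z → All (_< M) Z → AllPairs _<_ Z → length Z + length (shape Z) ≤ suc M
shape-fits M Z Z<M Z↑ = ≤-trans (+-monoʳ-≤ (length Z) parts≤blocks)
  (≤-trans (≤-reflexive (trans (cong (_+ length cs) (sym (decompose-sum Z))) (sym (span-sum cs)))) (decompose-span M Z Z<M Z↑))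
  where
  cs : List ℕ
  cs = decompose Z
  parts≤blocks : length (shape Z) ≤ length cs
  parts≤blocks = ≤-trans (≤-reflexive (length-shape Z)) (length-positives≤length cs)

-- Every simple braid is conjugate to the canonical word of a partition

module Canonical (m' : ℕ) where
  open Indexed m'
  open Conjugation m'
  open BlockConjugation m'

  PosConj⇒Conjugate : ∀ {Q u v} → PosConj Q u v → Conjugate (W u) (W v)
  PosConj⇒Conjugate {u = u} {v} (g , _ , ⟪ p ⟫) = W g , (begin
    W g ++ W u ++ invWord (W g)        ≈⟨ ≈-reflexive (trans (sym (++-assoc (W g) (W u) _)) (cong (_++ invWord (W g)) (sym (W-++ g u)))) ⟩
    W (g ++ u) ++ invWord (W g)        ≈⟨ ≈-cong [] (invWord (W g)) p ⟩
    W (v ++ g) ++ invWord (W g)        ≈⟨ ≈-reflexive (trans (cong (_++ invWord (W g)) (W-++ v g)) (trans (++-assoc (W v) (W g) _) (cong (W v ++_) (sym (++-identityʳ _))))) ⟩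
    W v ++ (W g ++ invWord (W g)) ++ [] ≈⟨ ≈-cong (W v) [] (invWord-inverseʳ (W g)) ⟩
    W v ++ [] ++ []                    ≈⟨ ≈-reflexive (++-identityʳ (W v)) ⟩
    W v ∎)
    where open ≈-Reasoning

  shape-conj : ∀ Z → AllPairs _<_ Z → All (_< m) Z → PosConj (From 0) Z (blocks 0 (shape Z))
  shape-conj Z Z↑ Z<m = subst₂ (PosConj (From 0)) (decompose-correct Z Z↑) (blocks-trailing-gaps 0 (shape Z) _)
    (blocks-permute 0 (shape-↭ Z) (decompose-span m Z Z<m Z↑))

  sorted : List (Fin m) → List ℕ
  sorted w = IncSort.sort (map toℕ w)

  sorted-↭ : ∀ w → map toℕ w ↭ sorted w
  sorted-↭ w = ↭-sym (IncSort.sort-↭ (map toℕ w))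

  sorted<m : ∀ w → All (_< m) (sorted w)
  sorted<m w = PermP.All-resp-↭ (sorted-↭ w) (AllP.map⁺ (All.tabulate (λ {x} _ → toℕ<n x)))

  sorted-increasing : ∀ w → AllPairs _≢_ w → AllPairs _<_ (sorted w)
  sorted-increasing w distinct = sort-increasing _ (APP.map⁺ (AllPairs.map (λ ne e → ne (toℕ-injective e)) distinct))

  sort-simple : ∀ w → AllPairs _≢_ w → PosConj (_< m) (map toℕ w) (sorted w)
  sort-simple w distinct = sort-into (map toℕ w) (sorted w) (sorted-↭ w) (sorted-increasing w distinct) (sorted<m w) (sorted<m w)

  W-toℕ : ∀ (w : List (Fin m)) → W (map toℕ w) ≡ pos w
  W-toℕ w = cong pos (trans (sym (map-∘ w)) (trans (map-cong ι-toℕ w) (map-id w)))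

  representative : ∀ {k} → Vec ℕ k → List (Fin m)
  representative v = map ι (blocks 0 (map pred (toList v)))

  complete : ∀ i (w : List (Fin m)) → SimpleWord i w →
             let k = i ⊓ (suc m ∸ i) in
             Σ (Vec ℕ k) λ v → v ∈ partitions (i + k) k × Conjugate (pos w) (pos (representative v))
  complete i w (distinct , len) = pad k (map suc sd) , ∈-partitions , subst₂ Conjugate (W-toℕ w) (cong W canonical≡) conj
    where
    k : ℕ
    k = i ⊓ (suc m ∸ i)
    Z : List ℕ
    Z = sorted w
    sd : List ℕ
    sd = shape Z
    Z<m : All (_< m) Z
    Z<m = sorted<m w
    Z↑ : AllPairs _<_ Z
    Z↑ = sorted-increasing w distinct
    length-Z : length Z ≡ i
    length-Z = trans (sym (PermP.↭-length (sorted-↭ w))) (trans (length-map toℕ w) len)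
    conj : Conjugate (W (map toℕ w)) (W (blocks 0 sd))
    conj = PosConj⇒Conjugate (PosConj-trans (PosConj-mono (z≤n ,_) (sort-simple w distinct)) (shape-conj Z Z↑ Z<m))
    sd≤i : length sd ≤ i
    sd≤i = subst (length sd ≤_) length-Z (length-shape≤length Z)
    sd≤n-i : length sd ≤ suc m ∸ i
    sd≤n-i = subst (_≤ suc m ∸ i) (m+n∸m≡n i (length sd))
      (∸-monoˡ-≤ i (subst (λ l → l + length sd ≤ suc m) length-Z (shape-fits m Z Z<m Z↑)))
    sd≤k : length sd ≤ k
    sd≤k = ⊓-glb sd≤i sd≤n-i
    ∈-partitions : pad k (map suc sd) ∈ partitions (i + k) k
    ∈-partitions = partitions-complete (i + k) (pad k (map suc sd))
      (padded-partition i k sd (sort-descending _) (shape-positive Z) (trans (sum-shape Z) length-Z) sd≤k)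
    canonical≡ : blocks 0 sd ≡ blocks 0 (map pred (toList (pad k (map suc sd))))
    canonical≡ = sym (trans (cong (blocks 0) (pred-pad k sd sd≤k)) (blocks-trailing-gaps 0 sd _))

-- The permutation of a braid
--
-- x_{j+1} acts on the points 0, 1, 2, … by the transposition (j j+1).

transposition : ℕ → ℕ → ℕ
transposition j x with x ≟ j
... | yes _ = suc j
... | no _ with x ≟ suc j
...   | yes _ = j
...   | no _ = x

transposition-at : ∀ j → transposition j j ≡ suc j
transposition-at j with j ≟ j
... | yes _ = refl
... | no j≢j = ⊥-elim (j≢j refl)

transposition-above : ∀ j → transposition j (suc j) ≡ j
transposition-above j with suc j ≟ j
... | yes e = ⊥-elim (<-irrefl (sym e) (n<1+n j))
... | no _ with suc j ≟ suc j
...   | yes _ = refl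
...   | no j≢j = ⊥-elim (j≢j refl)

transposition-away : ∀ {j x} → x ≢ j → x ≢ suc j → transposition j x ≡ x
transposition-away {j} {x} n₁ n₂ with x ≟ j
... | yes e = ⊥-elim (n₁ e)
... | no _ with x ≟ suc j
...   | yes e = ⊥-elim (n₂ e)
...   | no _ = refl

data Position (j x : ℕ) : Set where
  at    : x ≡ j → Position j x
  above : x ≡ suc j → Position j x
  away  : x ≢ j → x ≢ suc j → Position j x

position : ∀ j x → Position j x
position j x with x ≟ j
... | yes e = at e
... | no n₁ with x ≟ suc j
...   | yes e = above e
...   | no n₂ = away n₁ n₂

transposition-involutive : ∀ j x → transposition j (transposition j x) ≡ x
transposition-involutive j x with position j x
... | at refl = trans (cong (transposition j) (transposition-at j)) (transposition-above j)
... | above refl = trans (cong (transposition j) (transposition-above j)) (transposition-at j)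
... | away n₁ n₂ = trans (cong (transposition j) (transposition-away n₁ n₂)) (transposition-away n₁ n₂)

transposition-below : ∀ {j x} → x < j → transposition j x ≡ x
transposition-below h = transposition-away (<⇒≢ h) (<⇒≢ (≤-trans h (n≤1+n _)))

transposition-beyond : ∀ {j x} → suc j < x → transposition j x ≡ x
transposition-beyond h = transposition-away (≢-sym (<⇒≢ (≤-trans (n≤1+n _) h))) (≢-sym (<⇒≢ h))

transposition-commute : ∀ a b x → suc (suc a) ≤ b →
  transposition a (transposition b x) ≡ transposition b (transposition a x)
transposition-commute a b x h with position a x
... | at refl = trans (cong (transposition a) (transposition-below (≤-trans (n≤1+n _) h)))
    (trans (transposition-at a) (sym (trans (cong (transposition b) (transposition-at a)) (transposition-below h))))
... | above refl = trans (cong (transposition a) (transposition-below h))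
    (trans (transposition-above a) (sym (trans (cong (transposition b) (transposition-above a)) (transposition-below (≤-trans (n≤1+n _) h)))))
... | away n₁ n₂ with position b x
...   | at refl = trans (cong (transposition a) (transposition-at b))
    (trans (transposition-beyond (≤-trans h (n≤1+n b))) (sym (trans (cong (transposition b) (transposition-away n₁ n₂)) (transposition-at b))))
...   | above refl = trans (cong (transposition a) (transposition-above b))
    (trans (transposition-beyond h) (sym (trans (cong (transposition b) (transposition-away n₁ n₂)) (transposition-above b))))
...   | away m₁ m₂ = trans (cong (transposition a) (transposition-away m₁ m₂))
    (trans (transposition-away n₁ n₂) (sym (trans (cong (transposition b) (transposition-away n₁ n₂)) (transposition-away m₁ m₂))))

transposition-braid : ∀ a x →
  transposition a (transposition (suc a) (transposition a x)) ≡ transposition (suc a) (transposition a (transposition (suc a) x))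
transposition-braid a x with position a x
... | at refl = begin
  transposition a (transposition (suc a) (transposition a a)) ≡⟨ cong (λ z → transposition a (transposition (suc a) z)) (transposition-at a) ⟩
  transposition a (transposition (suc a) (suc a))             ≡⟨ cong (transposition a) (transposition-at (suc a)) ⟩
  transposition a (suc (suc a))                               ≡⟨ transposition-beyond ≤-refl ⟩
  suc (suc a)                                                 ≡⟨ sym (transposition-at (suc a)) ⟩
  transposition (suc a) (suc a)                               ≡⟨ cong (transposition (suc a)) (sym (transposition-at a)) ⟩
  transposition (suc a) (transposition a a)                   ≡⟨ cong (λ z → transposition (suc a) (transposition a z)) (sym (transposition-below (n<1+n a))) ⟩
  transposition (suc a) (transposition a (transposition (suc a) a)) ∎
  where open ≡-Reasoning
... | above refl = begin
  transposition a (transposition (suc a) (transposition a (suc a))) ≡⟨ cong (λ z → transposition a (transposition (suc a) z)) (transposition-above a) ⟩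
  transposition a (transposition (suc a) a)                         ≡⟨ cong (transposition a) (transposition-below (n<1+n a)) ⟩
  transposition a a                                                 ≡⟨ transposition-at a ⟩
  suc a                                                             ≡⟨ sym (transposition-above (suc a)) ⟩
  transposition (suc a) (suc (suc a))                               ≡⟨ cong (transposition (suc a)) (sym (transposition-beyond ≤-refl)) ⟩
  transposition (suc a) (transposition a (suc (suc a)))             ≡⟨ cong (λ z → transposition (suc a) (transposition a z)) (sym (transposition-at (suc a))) ⟩
  transposition (suc a) (transposition a (transposition (suc a) (suc a))) ∎
  where open ≡-Reasoning
... | away n₁ n₂ with position (suc a) x
...   | at e = ⊥-elim (n₂ e)
...   | above refl = begin
  transposition a (transposition (suc a) (transposition a (suc (suc a)))) ≡⟨ cong (λ z → transposition a (transposition (suc a) z)) (transposition-beyond ≤-refl) ⟩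
  transposition a (transposition (suc a) (suc (suc a)))                   ≡⟨ cong (transposition a) (transposition-above (suc a)) ⟩
  transposition a (suc a)                                                 ≡⟨ transposition-above a ⟩
  a                                                                       ≡⟨ sym (transposition-below (n<1+n a)) ⟩
  transposition (suc a) a                                                 ≡⟨ cong (transposition (suc a)) (sym (transposition-above a)) ⟩
  transposition (suc a) (transposition a (suc a))                         ≡⟨ cong (λ z → transposition (suc a) (transposition a z)) (sym (transposition-above (suc a))) ⟩
  transposition (suc a) (transposition a (transposition (suc a) (suc (suc a)))) ∎
  where open ≡-Reasoning
...   | away m₁ m₂ = begin
  transposition a (transposition (suc a) (transposition a x)) ≡⟨ cong (λ z → transposition a (transposition (suc a) z)) (transposition-away n₁ n₂) ⟩
  transposition a (transposition (suc a) x)                   ≡⟨ cong (transposition a) (transposition-away m₁ m₂) ⟩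
  transposition a x                                           ≡⟨ transposition-away n₁ n₂ ⟩
  x                                                           ≡⟨ sym (transposition-away m₁ m₂) ⟩
  transposition (suc a) x                                     ≡⟨ cong (transposition (suc a)) (sym (transposition-away n₁ n₂)) ⟩
  transposition (suc a) (transposition a x)                   ≡⟨ cong (λ z → transposition (suc a) (transposition a z)) (sym (transposition-away m₁ m₂)) ⟩
  transposition (suc a) (transposition a (transposition (suc a) x)) ∎
  where open ≡-Reasoning

transposition-bound : ∀ {j x M} → j < M → x < suc M → transposition j x < suc M
transposition-bound {j} {x} h hx with position j x
... | at refl = ≤-trans (≤-reflexive (cong suc (transposition-at j))) (s≤s h)
... | above refl = ≤-trans (≤-reflexive (cong suc (transposition-above j))) (≤-trans (n≤1+n _) hx)
... | away n₁ n₂ = ≤-trans (≤-reflexive (cong suc (transposition-away n₁ n₂))) hx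

iter : (ℕ → ℕ) → ℕ → ℕ → ℕ
iter f zero y = y
iter f (suc d) y = f (iter f d y)

returns : (ℕ → ℕ) → ℕ → ℕ → Bool
returns f d y = does (iter f d y ≟ y)

stays-away : (ℕ → ℕ) → ℕ → ℕ → Bool
stays-away f zero y = true
stays-away f (suc d) y = stays-away f d y ∧ not (returns f (suc d) y)

exact-period : (ℕ → ℕ) → ℕ → ℕ → Bool
exact-period f c y = returns f (suc c) y ∧ stays-away f c y

indicator : Bool → ℕ
indicator true = 1
indicator false = 0

sumRange : (ℕ → ℕ) → ℕ → ℕ → ℕ
sumRange F a zero = 0
sumRange F a (suc L) = F a + sumRange F (suc a) L

iter-conj : ∀ (f h τ : ℕ → ℕ) → (∀ y → f (τ y) ≡ τ (h y)) → ∀ d y → iter f d (τ y) ≡ τ (iter h d y)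
iter-conj f h τ conj zero y = refl
iter-conj f h τ conj (suc d) y = trans (cong f (iter-conj f h τ conj d y)) (conj (iter h d y))

-- Exact periods are preserved by conjugation with an injective map τ
-- (f ∘ τ = τ ∘ h); with τ = id this also says they only depend on f pointwise.
exact-period-conj : ∀ (f h τ τ' : ℕ → ℕ) → (∀ y → f (τ y) ≡ τ (h y)) → (∀ y → τ' (τ y) ≡ y) →
                    ∀ c y → exact-period f c (τ y) ≡ exact-period h c y
exact-period-conj f h τ τ' conj τ'τ c y = cong₂ _∧_ (returns-conj (suc c)) (stays-away-conj c)
  where
  τ-injective : ∀ {a b} → τ a ≡ τ b → a ≡ b
  τ-injective {a} {b} e = trans (sym (τ'τ a)) (trans (cong τ' e) (τ'τ b))
  returns-conj : ∀ d → returns f d (τ y) ≡ returns h d y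
  returns-conj d = trans (cong (λ z → does (z ≟ τ y)) (iter-conj f h τ conj d y))
    (does-⇔ (mk⇔ τ-injective (cong τ)) (τ (iter h d y) ≟ τ y) (iter h d y ≟ y))
  stays-away-conj : ∀ d → stays-away f d (τ y) ≡ stays-away h d y
  stays-away-conj zero = refl
  stays-away-conj (suc d) = cong₂ _∧_ (stays-away-conj d) (cong not (returns-conj (suc d)))

-- sumRange agrees with the library sum over Fin L (to apply sum-permute).
sumRange-Fin : ∀ L (F : ℕ → ℕ) → SumP.sum +-0-commutativeMonoid (λ (i : Fin L) → F (toℕ i)) ≡ sumRange F 0 L
sumRange-Fin zero F = refl
sumRange-Fin (suc L) F = cong (F 0 +_) (trans (sumRange-Fin L (F ∘ suc)) (shift F 0 L))
  where
  shift : ∀ F a L → sumRange (F ∘ suc) a L ≡ sumRange F (suc a) L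
  shift F a zero = refl
  shift F a (suc L) = cong (F (suc a) +_) (shift F (suc a) L)

module PermutationOf (m' : ℕ) where
  open Indexed m'

  index : Letter m → ℕ
  index (gen a) = toℕ a
  index (inv a) = toℕ a

  perm : Word m → ℕ → ℕ
  perm [] x = x
  perm (l ∷ w) x = transposition (index l) (perm w x)

  perm-++ : ∀ u v x → perm (u ++ v) x ≡ perm u (perm v x)
  perm-++ [] v x = refl
  perm-++ (l ∷ u) v x = cong (transposition (index l)) (perm-++ u v x)

  perm-rel : ∀ {u v : Word m} → Rel₀ u v → ∀ x → perm u x ≡ perm v x
  perm-rel (cancel-l a) x = transposition-involutive (toℕ a) x
  perm-rel (cancel-r a) x = transposition-involutive (toℕ a) x
  perm-rel (commute a b h) x = transposition-commute (toℕ a) (toℕ b) x h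
  perm-rel (braid a b e) x rewrite e = transposition-braid (toℕ a) x

  perm-≈ : ∀ {u v : Word m} → u ≈ v → ∀ x → perm u x ≡ perm v x
  perm-≈ (step {u} {v} p s r) x = begin
    perm (p ++ u ++ s) x       ≡⟨ perm-++ p (u ++ s) x ⟩
    perm p (perm (u ++ s) x)   ≡⟨ cong (perm p) (perm-++ u s x) ⟩
    perm p (perm u (perm s x)) ≡⟨ cong (perm p) (perm-rel r (perm s x)) ⟩
    perm p (perm v (perm s x)) ≡⟨ cong (perm p) (sym (perm-++ v s x)) ⟩
    perm p (perm (v ++ s) x)   ≡⟨ sym (perm-++ p (v ++ s) x) ⟩
    perm (p ++ v ++ s) x ∎
    where open ≡-Reasoning
  perm-≈ ≈refl x = refl
  perm-≈ (≈sym p) x = sym (perm-≈ p x)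
  perm-≈ (≈trans p q) x = trans (perm-≈ p x) (perm-≈ q x)

  perm-invWord-∷ : ∀ l g y → perm (invWord (l ∷ g)) y ≡ perm (invWord g) (transposition (index l) y)
  perm-invWord-∷ l g y = trans (cong (λ w → perm w y) (invWord-∷ l g)) (trans (perm-++ (invWord g) _ y) (cong (λ z → perm (invWord g) (transposition z y)) (index-inv l)))
    where
    index-inv : ∀ l → index (invLetter l) ≡ index l
    index-inv (gen a) = refl
    index-inv (inv a) = refl

  perm-inverseʳ : ∀ g y → perm g (perm (invWord g) y) ≡ y
  perm-inverseʳ [] y = refl
  perm-inverseʳ (l ∷ g) y = trans (cong (λ z → transposition (index l) (perm g z)) (perm-invWord-∷ l g y))
    (trans (cong (transposition (index l)) (perm-inverseʳ g (transposition (index l) y))) (transposition-involutive (index l) y))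

  perm-inverseˡ : ∀ g y → perm (invWord g) (perm g y) ≡ y
  perm-inverseˡ [] y = refl
  perm-inverseˡ (l ∷ g) y = trans (perm-invWord-∷ l g _)
    (trans (cong (perm (invWord g)) (transposition-involutive (index l) (perm g y))) (perm-inverseˡ g y))

  perm-bound : ∀ w y → y < suc m → perm w y < suc m
  perm-bound [] y h = h
  perm-bound (l ∷ w) y h = transposition-bound (index<m l) (perm-bound w y h)
    where
    index<m : ∀ l → index l < m
    index<m (gen a) = toℕ<n a
    index<m (inv a) = toℕ<n a

  perm-Fin : Word m → Permutation (suc m) (suc m)
  perm-Fin g = permutation (to g) (to (invWord g)) (inverse g (invWord g) (perm-inverseʳ g)) (inverse (invWord g) g (perm-inverseˡ g))
    where
    to : Word m → Fin (suc m) → Fin (suc m)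
    to g i = fromℕ< (perm-bound g (toℕ i) (toℕ<n i))
    inverse : ∀ g h → (∀ y → perm g (perm h y) ≡ y) → ∀ i → to g (to h i) ≡ i
    inverse g h gh i = toℕ-injective (trans (toℕ-fromℕ< _) (trans (cong (perm g) (toℕ-fromℕ< _)) (gh (toℕ i))))

  perm-Fin-toℕ : ∀ g i → toℕ (perm-Fin g ⟨$⟩ʳ i) ≡ perm g (toℕ i)
  perm-Fin-toℕ g i = toℕ-fromℕ< _

  period-count : Word m → ℕ → ℕ
  period-count u c = sumRange (indicator ∘ exact-period (perm u) c) 0 (suc m)

  -- It is a conjugacy invariant: conjugation by g relabels the points by perm g.
  period-count-conj : ∀ {u v : Word m} → Conjugate u v → ∀ c → period-count u c ≡ period-count v c
  period-count-conj {u} {v} (g , p) c = begin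
    sumRange Fu 0 (suc m)                        ≡⟨ sym (sumRange-Fin (suc m) Fu) ⟩
    SumP.sum +-0-commutativeMonoid (λ (i : Fin (suc m)) → Fu (toℕ i))          ≡⟨ sym (SumP.sum-cong-≗ +-0-commutativeMonoid relabel) ⟩
    SumP.sum +-0-commutativeMonoid (λ (i : Fin (suc m)) → Fv (toℕ (π ⟨$⟩ʳ i))) ≡⟨ sym (SumP.sum-permute +-0-commutativeMonoid (λ i → Fv (toℕ i)) π) ⟩
    SumP.sum +-0-commutativeMonoid (λ (i : Fin (suc m)) → Fv (toℕ i))          ≡⟨ sumRange-Fin (suc m) Fv ⟩
    sumRange Fv 0 (suc m) ∎
    where
    open ≡-Reasoning
    Fu : ℕ → ℕ
    Fu = indicator ∘ exact-period (perm u) c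
    Fv : ℕ → ℕ
    Fv = indicator ∘ exact-period (perm v) c
    π : Permutation (suc m) (suc m)
    π = perm-Fin g
    intertwines : ∀ y → perm v (perm g y) ≡ perm g (perm u y)
    intertwines y = begin
      perm v (perm g y)                                  ≡⟨ sym (perm-≈ p (perm g y)) ⟩
      perm (g ++ u ++ invWord g) (perm g y)              ≡⟨ perm-++ g _ (perm g y) ⟩
      perm g (perm (u ++ invWord g) (perm g y))          ≡⟨ cong (perm g) (perm-++ u _ (perm g y)) ⟩
      perm g (perm u (perm (invWord g) (perm g y)))      ≡⟨ cong (perm g ∘ perm u) (perm-inverseˡ g y) ⟩
      perm g (perm u y) ∎
    relabel : ∀ i → Fv (toℕ (π ⟨$⟩ʳ i)) ≡ Fu (toℕ i)
    relabel i = cong indicator (trans (cong (exact-period (perm v) c) (perm-Fin-toℕ g i))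
      (exact-period-conj (perm v) (perm u) (perm g) (perm (invWord g)) intertwines (perm-inverseˡ g) c (toℕ i)))

permIdx : List ℕ → ℕ → ℕ
permIdx [] y = y
permIdx (j ∷ Z) y = transposition j (permIdx Z y)

permIdx-++ : ∀ X Y y → permIdx (X ++ Y) y ≡ permIdx X (permIdx Y y)
permIdx-++ [] Y y = refl
permIdx-++ (j ∷ X) Y y = cong (transposition j) (permIdx-++ X Y y)

permIdx-below : ∀ {y} Z → All (y <_) Z → permIdx Z y ≡ y
permIdx-below [] _ = refl
permIdx-below (j ∷ Z) (h ∷ hs) = trans (cong (transposition j) (permIdx-below Z hs)) (transposition-below h)

permIdx-beyond : ∀ {y} Z → All (λ j → suc j < y) Z → permIdx Z y ≡ y
permIdx-beyond [] _ = refl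
permIdx-beyond (j ∷ Z) (h ∷ hs) = trans (cong (transposition j) (permIdx-beyond Z hs)) (transposition-beyond h)

run-perm-step : ∀ s c o → o < c → permIdx (run s c) (s + o) ≡ suc (s + o)
run-perm-step s (suc c) zero _ rewrite +-identityʳ s =
  trans (cong (transposition s) (permIdx-below (run (suc s) c) (run-all (suc s) c (λ a _ → a)))) (transposition-at s)
run-perm-step s (suc c) (suc o) (s≤s h) = begin
  transposition s (permIdx (run (suc s) c) (s + suc o)) ≡⟨ cong (λ z → transposition s (permIdx (run (suc s) c) z)) (+-suc s o) ⟩
  transposition s (permIdx (run (suc s) c) (suc s + o)) ≡⟨ cong (transposition s) (run-perm-step (suc s) c o h) ⟩
  transposition s (suc (suc s + o))                     ≡⟨ transposition-beyond (s≤s (s≤s (m≤m+n s o))) ⟩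
  suc (suc s + o)                                       ≡⟨ cong suc (sym (+-suc s o)) ⟩
  suc (s + suc o) ∎
  where open ≡-Reasoning

run-perm-wrap : ∀ s c → permIdx (run s c) (s + c) ≡ s
run-perm-wrap s zero = +-identityʳ s
run-perm-wrap s (suc c) = trans (cong (λ z → transposition s (permIdx (run (suc s) c) z)) (+-suc s c))
  (trans (cong (transposition s) (run-perm-wrap (suc s) c)) (transposition-above s))

record Cycle (σ : ℕ → ℕ) (s c : ℕ) : Set where
  field
    advance : ∀ o → o < c → σ (s + o) ≡ suc (s + o)
    close   : σ (s + c) ≡ s

block-cycle : ∀ pre s c post → All (λ j → suc j < s) pre → All (λ j → suc (s + c) ≤ j) post →
              Cycle (permIdx (pre ++ run s c ++ post)) s c
block-cycle pre s c post pre-below post-beyond = record { advance = advance ; close = wrap }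
  where
  split : ∀ y → permIdx (pre ++ run s c ++ post) y ≡ permIdx pre (permIdx (run s c) (permIdx post y))
  split y = trans (permIdx-++ pre _ y) (cong (permIdx pre) (permIdx-++ (run s c) post y))
  advance : ∀ o → o < c → permIdx (pre ++ run s c ++ post) (s + o) ≡ suc (s + o)
  advance o h = trans (split (s + o))
    (trans (cong (λ z → permIdx pre (permIdx (run s c) z)) (permIdx-below post (Amap (≤-trans (s≤s (<⇒≤ (+-monoʳ-< s h)))) post-beyond)))
      (trans (cong (permIdx pre) (run-perm-step s c o h)) (permIdx-beyond pre (Amap (λ q → ≤-trans q (≤-trans (m≤m+n s o) (n≤1+n _))) pre-below))))
  wrap : permIdx (pre ++ run s c ++ post) (s + c) ≡ s
  wrap = trans (split (s + c))
    (trans (cong (λ z → permIdx pre (permIdx (run s c) z)) (permIdx-below post post-beyond))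
      (trans (cong (permIdx pre) (run-perm-wrap s c)) (permIdx-beyond pre pre-below)))

iter-+ : ∀ σ a b y → iter σ (a + b) y ≡ iter σ a (iter σ b y)
iter-+ σ zero b y = refl
iter-+ σ (suc a) b y = cong σ (iter-+ σ a b y)

module _ {σ : ℕ → ℕ} {s c : ℕ} (cyc : Cycle σ s c) where
  cycle-walk : ∀ e p → p + e ≤ c → iter σ e (s + p) ≡ s + (p + e)
  cycle-walk zero p _ = cong (s +_) (sym (+-identityʳ p))
  cycle-walk (suc e) p h = begin
    σ (iter σ e (s + p)) ≡⟨ cong σ (cycle-walk e p (<⇒≤ p+e<c)) ⟩
    σ (s + (p + e))      ≡⟨ Cycle.advance cyc (p + e) p+e<c ⟩
    suc (s + (p + e))    ≡⟨ sym (+-suc s (p + e)) ⟩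
    s + suc (p + e)      ≡⟨ cong (s +_) (sym (+-suc p e)) ⟩
    s + (p + suc e) ∎
    where
    open ≡-Reasoning
    p+e<c : p + e < c
    p+e<c = ≤-trans (≤-reflexive (sym (+-suc p e))) h

  cycle-walk₀ : ∀ e → e ≤ c → iter σ e s ≡ s + e
  cycle-walk₀ e h = trans (cong (iter σ e) (sym (+-identityʳ s))) (cycle-walk e 0 h)

  cycle-wrap : ∀ o → o ≤ c → iter σ (suc (c ∸ o)) (s + o) ≡ s
  cycle-wrap o h = trans (cong σ (trans (cycle-walk (c ∸ o) o (≤-reflexive (m+[n∸m]≡n h))) (cong (s +_) (m+[n∸m]≡n h)))) (Cycle.close cyc)

  cycle-closes : ∀ o → o ≤ c → iter σ (suc c) (s + o) ≡ s + o
  cycle-closes o h = begin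
    iter σ (suc c) (s + o)                       ≡⟨ cong (λ z → iter σ z (s + o)) c+1≡ ⟩
    iter σ (o + suc (c ∸ o)) (s + o)             ≡⟨ iter-+ σ o (suc (c ∸ o)) (s + o) ⟩
    iter σ o (iter σ (suc (c ∸ o)) (s + o))      ≡⟨ cong (iter σ o) (cycle-wrap o h) ⟩
    iter σ o s                                   ≡⟨ cycle-walk₀ o h ⟩
    s + o ∎
    where
    open ≡-Reasoning
    c+1≡ : suc c ≡ o + suc (c ∸ o)
    c+1≡ = trans (cong suc (sym (m+[n∸m]≡n h))) (sym (+-suc o (c ∸ o)))

  -- No earlier return: either the walk stays inside the cycle without
  -- wrapping, or it wraps and then falls short of s + o.
  cycle-no-early-return : ∀ o d → o ≤ c → 1 ≤ d → d ≤ c → iter σ d (s + o) ≢ s + o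
  cycle-no-early-return o d o≤c 1≤d d≤c eq with (o + d) ≤? c
  ... | yes h = <-irrefl (sym (+-cancelˡ-≡ s (o + d) o (trans (sym (cycle-walk d o h)) eq)))
                         (≤-trans (≤-reflexive (cong suc (sym (+-identityʳ o)))) (+-monoʳ-< o 1≤d))
  ... | no h = <-irrefl d'≡o d'<o
    where
    D : ℕ
    D = c ∸ o
    oD : o + D ≡ c
    oD = m+[n∸m]≡n o≤c
    D<d : D < d
    D<d = +-cancelˡ-< o D d (≤-trans (s≤s (≤-reflexive oD)) (≰⇒> h))
    d' : ℕ
    d' = d ∸ suc D
    dd : d ≡ d' + suc D
    dd = sym (m∸n+n≡m D<d)
    d'<o : d' < o
    d'<o = +-cancelʳ-< D d' o (≤-trans (≤-reflexive (trans (sym (+-suc d' D)) (sym dd))) (≤-trans d≤c (≤-reflexive (sym oD))))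
    d'≡o : d' ≡ o
    d'≡o = +-cancelˡ-≡ s d' o (begin
      s + d'                               ≡⟨ sym (cycle-walk₀ d' (≤-trans (<⇒≤ d'<o) o≤c)) ⟩
      iter σ d' s                          ≡⟨ cong (iter σ d') (sym (cycle-wrap o o≤c)) ⟩
      iter σ d' (iter σ (suc D) (s + o))   ≡⟨ sym (iter-+ σ d' (suc D) (s + o)) ⟩
      iter σ (d' + suc D) (s + o)          ≡⟨ cong (λ z → iter σ z (s + o)) (sym dd) ⟩
      iter σ d (s + o)                     ≡⟨ eq ⟩
      s + o ∎)
      where open ≡-Reasoning

stays-away-false : ∀ (f : ℕ → ℕ) y c d → 1 ≤ d → d ≤ c → iter f d y ≡ y → stays-away f c y ≡ false
stays-away-false f y zero d 1≤d d≤c _ = ⊥-elim (<-irrefl refl (≤-trans 1≤d d≤c))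
stays-away-false f y (suc c) d 1≤d d≤c ret with d ≟ suc c
... | yes refl = trans (cong (λ b → stays-away f c y ∧ not b) (dec-true (iter f (suc c) y ≟ y) ret)) (∧-zeroʳ _)
... | no d≢ = cong (_∧ not (returns f (suc c) y)) (stays-away-false f y c d 1≤d (≤-pred (≤∧≢⇒< d≤c d≢)) ret)

stays-away-true : ∀ (f : ℕ → ℕ) y c → (∀ d → 1 ≤ d → d ≤ c → iter f d y ≢ y) → stays-away f c y ≡ true
stays-away-true f y zero _ = refl
stays-away-true f y (suc c) h = cong₂ _∧_ (stays-away-true f y c (λ d a b → h d a (≤-trans b (n≤1+n c))))
  (cong not (dec-false (iter f (suc c) y ≟ y) (h (suc c) (s≤s z≤n) ≤-refl)))

cycle-exact-period : ∀ {σ s c} → Cycle σ s c → ∀ o → o ≤ c → ∀ c' → exact-period σ c' (s + o) ≡ does (c ≟ c')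
cycle-exact-period {σ} {s} {c} cyc o o≤c c' with <-cmp c' c
... | tri≈ _ refl _ = trans (cong₂ _∧_ (dec-true (_ ≟ _) (cycle-closes cyc o o≤c))
                                       (stays-away-true σ (s + o) c (λ d a b → cycle-no-early-return cyc o d o≤c a b)))
                            (sym (dec-true (c ≟ c) refl))
... | tri< c'<c _ _ = trans (cong (_∧ stays-away σ c' (s + o)) (dec-false (_ ≟ _) (cycle-no-early-return cyc o (suc c') o≤c (s≤s z≤n) c'<c)))
                            (sym (dec-false (c ≟ c') (λ e → <-irrefl (sym e) c'<c)))
... | tri> _ _ c<c' = trans (trans (cong (returns σ (suc c') (s + o) ∧_) (stays-away-false σ (s + o) c' (suc c) (s≤s z≤n) c<c' (cycle-closes cyc o o≤c))) (∧-zeroʳ _))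
                            (sym (dec-false (c ≟ c') (λ e → <-irrefl e c<c')))

sumRange-++ : ∀ F a L₁ L₂ → sumRange F a (L₁ + L₂) ≡ sumRange F a L₁ + sumRange F (a + L₁) L₂
sumRange-++ F a zero L₂ = cong (λ z → sumRange F z L₂) (sym (+-identityʳ a))
sumRange-++ F a (suc L₁) L₂ =
  trans (cong (F a +_) (trans (sumRange-++ F (suc a) L₁ L₂) (cong (λ z → sumRange F (suc a) L₁ + sumRange F z L₂) (sym (+-suc a L₁)))))
    (sym (+-assoc (F a) _ _))

sumRange-const : ∀ F a L v → (∀ o → o < L → F (a + o) ≡ v) → sumRange F a L ≡ L * v
sumRange-const F a zero v h = refl
sumRange-const F a (suc L) v h = cong₂ _+_ (trans (cong F (sym (+-identityʳ a))) (h 0 (s≤s z≤n)))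
  (sumRange-const F (suc a) L v (λ o o<L → trans (cong F (sym (+-suc a o))) (h (suc o) (s≤s o<L))))

sumRange-cong : ∀ {F G : ℕ → ℕ} a L → (∀ y → F y ≡ G y) → sumRange F a L ≡ sumRange G a L
sumRange-cong a zero h = refl
sumRange-cong a (suc L) h = cong₂ _+_ (h a) (sumRange-cong (suc a) L h)

multiplicity : ℕ → List ℕ → ℕ
multiplicity c [] = 0
multiplicity c (c' ∷ cs) = indicator (does (c' ≟ c)) + multiplicity c cs

blocks-period-count : ∀ cs s pre c' → All (λ j → suc j < s) pre →
  sumRange (indicator ∘ exact-period (permIdx (pre ++ blocks s cs)) c') s (span cs) ≡ suc c' * multiplicity c' cs
blocks-period-count [] s pre c' _ = sym (*-zeroʳ c')
blocks-period-count (c ∷ cs) s pre c' pre-below = begin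
  sumRange F s (suc c + span cs)                                   ≡⟨ sumRange-++ F s (suc c) (span cs) ⟩
  sumRange F s (suc c) + sumRange F (s + suc c) (span cs)          ≡⟨ cong₂ _+_ this-block later-blocks ⟩
  suc c' * indicator (does (c ≟ c')) + suc c' * multiplicity c' cs ≡⟨ sym (*-distribˡ-+ (suc c') (indicator (does (c ≟ c'))) (multiplicity c' cs)) ⟩
  suc c' * multiplicity c' (c ∷ cs) ∎
  where
  open ≡-Reasoning
  word : List ℕ
  word = pre ++ run s c ++ blocks (suc (s + c)) cs
  F : ℕ → ℕ
  F = indicator ∘ exact-period (permIdx word) c'
  cyc : Cycle (permIdx word) s c
  cyc = block-cycle pre s c (blocks (suc (s + c)) cs) pre-below (Amap proj₁ (blocks-all (suc (s + c)) cs))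
  same-length : suc c * indicator (does (c ≟ c')) ≡ suc c' * indicator (does (c ≟ c'))
  same-length with c ≟ c'
  ... | yes refl = refl
  ... | no c≢c' = begin
    suc c * indicator (does (c ≟ c'))  ≡⟨ cong (λ b → suc c * indicator b) (dec-false (c ≟ c') c≢c') ⟩
    suc c * 0                          ≡⟨ trans (*-zeroʳ (suc c)) (sym (*-zeroʳ (suc c'))) ⟩
    suc c' * 0                         ≡⟨ cong (λ b → suc c' * indicator b) (sym (dec-false (c ≟ c') c≢c')) ⟩
    suc c' * indicator (does (c ≟ c')) ∎
  this-block : sumRange F s (suc c) ≡ suc c' * indicator (does (c ≟ c'))
  this-block = trans (sumRange-const F s (suc c) _ (λ o o≤c → cong indicator (cycle-exact-period cyc o (≤-pred o≤c) c'))) same-length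
  later-blocks : sumRange F (s + suc c) (span cs) ≡ suc c' * multiplicity c' cs
  later-blocks = trans (cong₂ (λ w z → sumRange (indicator ∘ exact-period (permIdx w) c') z (span cs)) (sym (++-assoc pre (run s c) _)) (+-suc s c))
    (blocks-period-count cs (suc (s + c)) (pre ++ run s c) c'
      (AllP.++⁺ (Amap (λ q → ≤-trans q (≤-trans (m≤m+n s c) (n≤1+n _))) pre-below) (run-all s c (λ _ b → s≤s b))))

multiplicity-head : ∀ x xs → 1 ≤ multiplicity x (x ∷ xs)
multiplicity-head x xs rewrite dec-true (x ≟ x) refl = s≤s z≤n

multiplicity-∈ : ∀ c l → 1 ≤ multiplicity c l → c ∈ l
multiplicity-∈ c [] ()
multiplicity-∈ c (z ∷ l) h with z ≟ c
... | yes refl = here refl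
... | no z≢c = there (multiplicity-∈ c l (subst (λ b → 1 ≤ indicator b + multiplicity c l) (dec-false (z ≟ c) z≢c) h))

∈-descending-≤ : ∀ {c y ys} → Descending (y ∷ ys) → c ∈ (y ∷ ys) → c ≤ y
∈-descending-≤ _ (here refl) = ≤-refl
∈-descending-≤ (y≥ ∷ _) (there c∈ys) = All.lookup y≥ c∈ys

heads-equal : ∀ x y → (1 ≤ x → x ≤ y) → (1 ≤ y → y ≤ x) → x ≡ y
heads-equal zero zero _ _ = refl
heads-equal zero (suc b) _ y≤x with y≤x (s≤s z≤n)
... | ()
heads-equal (suc a) zero x≤y _ with x≤y (s≤s z≤n)
... | ()
heads-equal (suc a) (suc b) x≤y y≤x = ≤-antisym (x≤y (s≤s z≤n)) (y≤x (s≤s z≤n))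

descending-unique : ∀ xs ys → Descending xs → Descending ys → length xs ≡ length ys →
                    (∀ c → 1 ≤ c → multiplicity c xs ≡ multiplicity c ys) → xs ≡ ys
descending-unique [] [] _ _ _ _ = refl
descending-unique (x ∷ xs) (y ∷ ys) xs↓@(_ ∷ xs↓') ys↓@(_ ∷ ys↓') len same =
  cong₂ _∷_ x≡y (descending-unique xs ys xs↓' ys↓' (suc-injective len) same-tail)
  where
  x≤y : 1 ≤ x → x ≤ y
  x≤y 1≤x = ∈-descending-≤ ys↓ (multiplicity-∈ x (y ∷ ys) (≤-trans (multiplicity-head x xs) (≤-reflexive (same x 1≤x))))
  y≤x : 1 ≤ y → y ≤ x
  y≤x 1≤y = ∈-descending-≤ xs↓ (multiplicity-∈ y (x ∷ xs) (≤-trans (multiplicity-head y ys) (≤-reflexive (sym (same y 1≤y)))))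
  x≡y : x ≡ y
  x≡y = heads-equal x y x≤y y≤x
  same-tail : ∀ c → 1 ≤ c → multiplicity c xs ≡ multiplicity c ys
  same-tail c 1≤c = +-cancelˡ-≡ (indicator (does (y ≟ c))) (multiplicity c xs) (multiplicity c ys)
    (trans (cong (λ z → indicator (does (z ≟ c)) + multiplicity c xs) (sym x≡y)) (same c 1≤c))

block-lengths : ∀ {k} → Vec ℕ k → List ℕ
block-lengths v = map pred (toList v)

span-block-lengths : ∀ M {k} (v : Vec ℕ k) → IsPartition M v → span (block-lengths v) ≡ M
span-block-lengths M {k} v (sum≡ , _ , pos) = begin
  span (map pred (toList v))                         ≡⟨ span-sum (map pred (toList v)) ⟩
  sum (map pred (toList v)) + length (map pred (toList v)) ≡⟨ cong (sum (map pred (toList v)) +_) (length-map pred (toList v)) ⟩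
  sum (map pred (toList v)) + length (toList v)      ≡⟨ minus-ones (toList v) pos ⟩
  sum (toList v)                                     ≡⟨ trans (sym (sum-toList v)) sum≡ ⟩
  M ∎
  where
  open ≡-Reasoning
  minus-ones : ∀ l → All (1 ≤_) l → sum (map pred l) + length l ≡ sum l
  minus-ones [] _ = refl
  minus-ones (suc x ∷ l) (_ ∷ ps) = trans (+-suc (x + sum (map pred l)) (length l))
    (cong suc (trans (+-assoc x _ _) (cong (x +_) (minus-ones l ps))))

block-lengths-injective : ∀ M {k} (u v : Vec ℕ k) → IsPartition M u → IsPartition M v → block-lengths u ≡ block-lengths v → u ≡ v
block-lengths-injective M u v (_ , _ , u-pos) (_ , _ , v-pos) e =
  trans (sym (cast-is-id refl u)) (toList-injective refl u v (trans (sym (add-back (toList u) u-pos)) (trans (cong (map suc) e) (add-back (toList v) v-pos))))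
  where
  add-back : ∀ l → All (1 ≤_) l → map suc (map pred l) ≡ l
  add-back [] _ = refl
  add-back (suc x ∷ l) (_ ∷ ps) = cong (suc x ∷_) (add-back l ps)

block-lengths-descending : ∀ M {k} (v : Vec ℕ k) → IsPartition M v → Descending (block-lengths v)
block-lengths-descending M v (_ , desc , _) = APP.map⁺ (AllPairs.map pred-mono-≤ desc)

-- Canonical words of distinct partitions are not conjugate

module Classification (m' : ℕ) where
  open Indexed m'
  open BlockConjugation m' using (blocks<m)
  open PermutationOf m'
  open Canonical m'

  perm-W : ∀ Z → All (_< m) Z → ∀ y → perm (W Z) y ≡ permIdx Z y
  perm-W [] _ y = refl
  perm-W (j ∷ Z) (j<m ∷ Z<m) y = cong₂ transposition (toℕ-ι j<m) (perm-W Z Z<m y)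

  -- For c' ≥ 1 the invariant counts the blocks of length c': the points
  -- beyond the blocks are fixed, so they never have exact period c' + 1.
  period-count-blocks : ∀ cs → span cs ≤ suc m → ∀ c' → 1 ≤ c' → period-count (W (blocks 0 cs)) c' ≡ suc c' * multiplicity c' cs
  period-count-blocks cs fits c' 1≤c' = begin
    sumRange (indicator ∘ exact-period (perm (W Z)) c') 0 (suc m)     ≡⟨ sumRange-cong 0 (suc m) (λ y → cong indicator (exact-period-conj _ _ id id (perm-W Z Z<m) (λ _ → refl) c' y)) ⟩
    sumRange F 0 (suc m)                                             ≡⟨ cong (sumRange F 0) (sym (m+[n∸m]≡n fits)) ⟩
    sumRange F 0 (span cs + (suc m ∸ span cs))                       ≡⟨ sumRange-++ F 0 (span cs) (suc m ∸ span cs) ⟩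
    sumRange F 0 (span cs) + sumRange F (span cs) (suc m ∸ span cs)  ≡⟨ cong₂ _+_ (blocks-period-count cs 0 [] c' []) (sumRange-const F (span cs) _ 0 beyond-blocks) ⟩
    suc c' * multiplicity c' cs + (suc m ∸ span cs) * 0              ≡⟨ trans (cong (suc c' * multiplicity c' cs +_) (*-zeroʳ (suc m ∸ span cs))) (+-identityʳ _) ⟩
    suc c' * multiplicity c' cs ∎
    where
    open ≡-Reasoning
    Z : List ℕ
    Z = blocks 0 cs
    Z<m : All (_< m) Z
    Z<m = blocks<m 0 cs fits
    F : ℕ → ℕ
    F = indicator ∘ exact-period (permIdx Z) c'
    beyond-blocks : ∀ o → o < suc m ∸ span cs → F (span cs + o) ≡ 0
    beyond-blocks o _ = cong indicator (trans (cong (returns (permIdx Z) (suc c') (span cs + o) ∧_)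
      (stays-away-false (permIdx Z) (span cs + o) c' 1 ≤-refl 1≤c' fixed)) (∧-zeroʳ _))
      where
      fixed : permIdx Z (span cs + o) ≡ span cs + o
      fixed = permIdx-beyond Z (Amap (λ q → ≤-trans (proj₂ q) (m≤m+n (span cs) o)) (blocks-all 0 cs))

  representative-injective : ∀ M {k} (u v : Vec ℕ k) → M ≤ suc m → IsPartition M u → IsPartition M v →
                             Conjugate (pos (representative u)) (pos (representative v)) → u ≡ v
  representative-injective M u v M≤ u-part v-part conj = block-lengths-injective M u v u-part v-part
    (descending-unique (block-lengths u) (block-lengths v) (block-lengths-descending M u u-part) (block-lengths-descending M v v-part)
      (trans (length-map pred (toList u)) (trans (length-toList u) (sym (trans (length-map pred (toList v)) (length-toList v)))))
      same-multiplicities)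
    where
    fits : ∀ {w} → IsPartition M w → span (block-lengths w) ≤ suc m
    fits {w} w-part = ≤-trans (≤-reflexive (span-block-lengths M w w-part)) M≤
    same-multiplicities : ∀ c → 1 ≤ c → multiplicity c (block-lengths u) ≡ multiplicity c (block-lengths v)
    same-multiplicities c 1≤c = *-cancelˡ-≡ _ _ (suc c) (begin
      suc c * multiplicity c (block-lengths u)            ≡⟨ sym (period-count-blocks (block-lengths u) (fits u-part) c 1≤c) ⟩
      period-count (W (blocks 0 (block-lengths u))) c     ≡⟨ period-count-conj conj c ⟩
      period-count (W (blocks 0 (block-lengths v))) c     ≡⟨ period-count-blocks (block-lengths v) (fits v-part) c 1≤c ⟩
      suc c * multiplicity c (block-lengths v) ∎)
      where open ≡-Reasoning

  representative-simple : ∀ i k (v : Vec ℕ k) → i + k ≤ suc m → IsPartition (i + k) v → SimpleWord i (representative v)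
  representative-simple i k v fits v-part = distinct Z (blocks-increasing 0 cs) Z<m , length≡
    where
    cs : List ℕ
    cs = block-lengths v
    Z : List ℕ
    Z = blocks 0 cs
    span≤ : span cs ≤ suc m
    span≤ = ≤-trans (≤-reflexive (span-block-lengths (i + k) v v-part)) fits
    Z<m : All (_< m) Z
    Z<m = blocks<m 0 cs span≤
    distinct : ∀ Z → AllPairs _<_ Z → All (_< m) Z → AllPairs _≢_ (map ι Z)
    distinct [] _ _ = []
    distinct (z ∷ Z) (z< ∷ Z↑) (z<m ∷ Z<m) =
      AllP.map⁺ (zipWith (λ { (z<b , b<m) e → <-irrefl (trans (sym (toℕ-ι z<m)) (trans (cong toℕ e) (toℕ-ι b<m))) z<b }) (z< , Z<m))
        ∷ distinct Z Z↑ Z<m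
    sum-cs : sum cs ≡ i
    sum-cs = +-cancelʳ-≡ k (sum cs) i (begin
      sum cs + k              ≡⟨ cong (sum cs +_) (sym (trans (length-map pred (toList v)) (length-toList v))) ⟩
      sum cs + length cs      ≡⟨ sym (span-sum cs) ⟩
      span cs                 ≡⟨ span-block-lengths (i + k) v v-part ⟩
      i + k ∎)
      where open ≡-Reasoning
    length≡ : length (representative v) ≡ i
    length≡ = trans (length-map ι Z) (trans (length-blocks 0 cs) sum-cs)

AllPairs-refine : ∀ {A : Set} {R R' : A → A → Set} {Q : A → Set} {L} → AllPairs R L → All Q L →
                  (∀ {a b} → Q a → Q b → R a b → R' a b) → AllPairs R' L
AllPairs-refine [] [] f = []
AllPairs-refine (r ∷ rs) (q ∷ qs) f = zipWith (λ { (q' , r') → f q q' r' }) (qs , r) ∷ AllPairs-refine rs qs f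

proposition5p1 : (n i : ℕ) → 2 ≤ n → i ≤ n ∸ 1 →
    ConjClassCount n i (P (i + (i ⊓ (n ∸ i))) (i ⊓ (n ∸ i)))
proposition5p1 (suc zero) i (s≤s ()) _
proposition5p1 (suc (suc m')) i _ i≤m = map representative reps , length-map representative reps , all-simple , pairwise-non-conjugate , every-simple
  where
  open Indexed m'
  open Canonical m'
  open Classification m'
  k : ℕ
  k = i ⊓ (suc m ∸ i)
  reps : List (Vec ℕ k)
  reps = partitions (i + k) k
  i+k≤n : i + k ≤ suc m
  i+k≤n = ≤-trans (+-monoʳ-≤ i (m⊓n≤n i (suc m ∸ i))) (≤-reflexive (m+[n∸m]≡n (≤-trans i≤m (n≤1+n m))))
  all-simple : All (SimpleWord i) (map representative reps)
  all-simple = AllP.map⁺ (Amap (representative-simple i k _ i+k≤n) (partitions-sound (i + k) k))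
  pairwise-non-conjugate : AllPairs (λ u v → ¬ Conjugate (pos u) (pos v)) (map representative reps)
  pairwise-non-conjugate = APP.map⁺ (AllPairs-refine (partitions-unique (i + k) k) (partitions-sound (i + k) k)
    (λ u-part v-part u≢v conj → u≢v (representative-injective (i + k) _ _ i+k≤n u-part v-part conj)))
  every-simple : ∀ w → SimpleWord i w → Any (λ r → Conjugate (pos w) (pos r)) (map representative reps)
  every-simple w simple with complete i w simple
  ... | v , v∈reps , conj = AnyP.map⁺ (Any.map (λ { refl → conj }) v∈reps)
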